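{- Let $t\geq 4$, let $G$ be a connected $K^2_t$-saturated graph of order $n$, and let $G'$ be the graph obtained from $G$ by deleting all vertices of every type-II $K_t$ and of every unlucky $K_{t-1}$. Then $G'$ is a connected $K_t$-free graph with $e(G)\geq e(G')+\frac{t}{2}|V(G)\setminus V(G')|$, and equality holds if and only if $t=4$ or every $K_t$ in $G$ is a type-I $K_t$.
   Context: All graphs are finite and simple; $e(G)$ is the number of edges, $d(v)$ the degree. For $t\ge3$, the virus $K^2_t$ is the graph on $t+2$ vertices obtained from $K_t$ by attaching one pendant vertex to each of two distinct vertices of $K_t$. A graph $G$ is $K^2_t$-saturated if it contains no subgraph isomorphic to $K^2_t$ but $G+uv$ contains one for every pair of non-adjacent vertices $u,v$; a graph with fewer than $t+2$ vertices is not $K^2_t$-saturated by convention. Let $G$ be a connected $K^2_t$-saturated graph, $t\ge4$, and $V_1=\{v_1,\dots,v_t\}$ with $G[V_1]\cong K_t$. If there is $i$ such that $v_i$ is a cut vertex of $G$ and $d(v_j)=t-1$ for all $j\neq i$, then $G[V_1]$ is called a type-I $K_t$, $G[V_1\setminus\{v_i\}]$ an unlucky $K_{t-1}$, and $v_i$ a lucky vertex. If there are distinct $i,j$ with $d(v_i)=d(v_j)=t-1$ and $d(v_k)=t$ for all $k\ne i,j$, with some vertex $v\notin V_1$ adjacent to these $v_k$, then $G[V_1]$ is called a type-II $K_t$. (Every copy of $K_t$ in such $G$ is of type I or type II.) -}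

module Defs where

open import Data.Nat using (ℕ; zero; suc; _+_; _∸_; _<ᵇ_; _≡ᵇ_)
open import Data.Bool using (Bool; true; false; _∧_; _∨_; T; if_then_else_)
open import Data.Fin as F using (Fin; toℕ; _≟_)
open import Data.Product using (Σ; ∃; ∃-syntax; _×_; _,_)
open import Data.Sum using (_⊎_)
open import Data.Unit using (⊤)
open import Relation.Nullary using (¬_)
open import Relation.Nullary.Decidable using (⌊_⌋)
open import Relation.Binary.PropositionalEquality using (_≡_; _≢_)
open import Function.Definitions using (Injective)

Adjacency : ℕ → Set
Adjacency n = Fin n → Fin n → Bool

record Graph (n : ℕ) : Set where
  field
    adj    : Adjacency n
    sym    : ∀ i j → adj i j ≡ adj j i
    irrefl : ∀ i → adj i i ≡ false
open Graph public

addEdge : ∀ {n} → Adjacency n → Fin n → Fin n → Adjacency n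
addEdge a u v i j =
  a i j ∨ ((⌊ i ≟ u ⌋ ∧ ⌊ j ≟ v ⌋) ∨ (⌊ i ≟ v ⌋ ∧ ⌊ j ≟ u ⌋))

sumFin : ∀ {n} → (Fin n → ℕ) → ℕ
sumFin {zero}  f = 0
sumFin {suc n} f = f F.zero + sumFin {n} (λ i → f (F.suc i))

count : ∀ {n} → (Fin n → Bool) → ℕ
count p = sumFin (λ i → if p i then 1 else 0)

deg : ∀ {n} → Graph n → Fin n → ℕ
deg G v = count (adj G v)

edgesIn : ∀ {n} → Graph n → (Fin n → Bool) → ℕ
edgesIn G keep =
  sumFin (λ i → count (λ j → keep i ∧ keep j ∧ adj G i j ∧ (toℕ i <ᵇ toℕ j)))

edges : ∀ {n} → Graph n → ℕ
edges G = edgesIn G (λ _ → true)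

Contains : ∀ {n m} → Adjacency n → Adjacency m → Set
Contains {n} {m} a H =
  Σ (Fin m → Fin n) λ f → Injective _≡_ _≡_ f × (∀ i j → T (H i j) → T (a (f i) (f j)))

-- The virus K^2_t on vertex set Fin (t+2): vertices 0..t-1 form K_t,
-- vertex t is a pendant vertex attached to 0, vertex t+1 a pendant vertex
-- attached to 1.
virusAdj : (t : ℕ) → Adjacency (t + 2)
virusAdj t i j =
  (not≡ ∧ (toℕ i <ᵇ t) ∧ (toℕ j <ᵇ t))
  ∨ ((toℕ i ≡ᵇ t) ∧ (toℕ j ≡ᵇ 0)) ∨ ((toℕ j ≡ᵇ t) ∧ (toℕ i ≡ᵇ 0))
  ∨ ((toℕ i ≡ᵇ suc t) ∧ (toℕ j ≡ᵇ 1)) ∨ ((toℕ j ≡ᵇ suc t) ∧ (toℕ i ≡ᵇ 1))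
  where
    not≡ : Bool
    not≡ = if toℕ i ≡ᵇ toℕ j then false else true

-- K^2_t-saturated (graphs with fewer than t+2 vertices are not saturated)
Saturated : ∀ {n} → ℕ → Graph n → Set
Saturated {n} t G =
  (t + 2 Data.Nat.≤ n)
  × ¬ Contains (adj G) (virusAdj t)
  × (∀ u v → u ≢ v → adj G u v ≡ false → Contains (addEdge (adj G) u v) (virusAdj t))
  where import Data.Nat

data Walk {n} (G : Graph n) (P : Fin n → Set) : Fin n → Fin n → Set where
  here : ∀ {u} → P u → Walk G P u u
  step : ∀ {u v w} → P u → T (adj G u v) → Walk G P v w → Walk G P u w

Connected : ∀ {n} → Graph n → Set
Connected G = ∀ u v → Walk G (λ _ → ⊤) u v

ConnectedOn : ∀ {n} → Graph n → (Fin n → Set) → Set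
ConnectedOn G P = ∀ u v → P u → P v → Walk G P u v

-- v is a cut vertex: G - v has two vertices not joined by a walk avoiding v
-- (G is assumed connected where this is used)
CutVertex : ∀ {n} → Graph n → Fin n → Set
CutVertex G v = ∃[ u ] ∃[ w ] (u ≢ v × w ≢ v × ¬ Walk G (λ x → x ≢ v) u w)

IsKt : ∀ {n} (t : ℕ) → Graph n → (Fin t → Fin n) → Set
IsKt t G f = Injective _≡_ _≡_ f × (∀ i j → i ≢ j → T (adj G (f i) (f j)))

KtFreeOn : ∀ {n} (t : ℕ) → Graph n → (Fin n → Set) → Set
KtFreeOn {n} t G P = ∀ (f : Fin t → Fin n) → IsKt t G f → ¬ (∀ i → P (f i))

LuckyAt : ∀ {n} (t : ℕ) → Graph n → (Fin t → Fin n) → Fin t → Set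
LuckyAt t G f i = CutVertex G (f i) × (∀ j → j ≢ i → deg G (f j) ≡ t ∸ 1)

TypeI : ∀ {n} (t : ℕ) → Graph n → (Fin t → Fin n) → Set
TypeI t G f = ∃[ i ] LuckyAt t G f i

TypeII : ∀ {n} (t : ℕ) → Graph n → (Fin t → Fin n) → Set
TypeII {n} t G f =
  ∃[ i ] ∃[ j ] (i ≢ j × deg G (f i) ≡ t ∸ 1 × deg G (f j) ≡ t ∸ 1
    × (∀ k → k ≢ i → k ≢ j → deg G (f k) ≡ t)
    × ∃[ v ] ((∀ k → f k ≢ v) × (∀ k → k ≢ i → k ≢ j → T (adj G v (f k)))))

-- x is a vertex of some type-II K_t, or of some unlucky K_{t-1}
-- (the type-I K_t minus its lucky vertex)
Deleted : ∀ {n} (t : ℕ) → Graph n → Fin n → Set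
Deleted t G x =
  (∃[ f ] (IsKt t G f × TypeII t G f × ∃[ k ] f k ≡ x))
  ⊎ (∃[ f ] (IsKt t G f × ∃[ i ] (LuckyAt t G f i × ∃[ k ] (k ≢ i × f k ≡ x))))

module Submission where

-- Every K_t of G is of type I or II. An edge leaves each K_t (G is connected), and two disjoint
-- pendant edges at a K_t would complete a virus; so either one clique vertex carries all outside
-- neighbours (type I: it is a cut vertex, the others have degree t − 1), or all of them go to a single
-- hub w. In the latter case saturation, applied to the non-edge between w and a clique vertex,
-- shows that at most two clique vertices miss w, and replacing a clique vertex by w shows that at
-- least two do (type II).
--
-- The deleted vertices split into pockets (an unlucky K_{t−1}, or a type-II K_t) whose only
-- neighbour outside is a surviving vertex (the lucky vertex, resp. the hub), so G′ stays
-- connected, and G′ is K_t-free because every K_t loses a vertex. Finally 2e(G) − 2e(G′) is the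
-- sum of d(x) + d_{G′}(x) over deleted x; after each deleted vertex of degree t sends one unit to
-- every deleted neighbour, each deleted vertex holds exactly 2t, except the two vertices of degree
-- t − 1 of a type-II K_t, which hold 2t + (t − 4).

open import Defs hiding (sym)
open import Data.Bool using (Bool; true; false; not; T; _∧_; _∨_; if_then_else_)
open import Data.Bool.Properties using (T?; T-≡; T-∧; T-∨; T-not-≡; ∧-identityʳ; ∨-identityʳ)
open import Data.Empty using (⊥; ⊥-elim)
open import Data.Fin using (Fin; zero; suc; toℕ; _≟_; _↑ˡ_; _↑ʳ_; splitAt)
open import Data.Fin.Permutation.Components using (transpose; transpose-inverse)
open import Data.Fin.Properties
  using (any?; toℕ-injective; toℕ-↑ˡ; toℕ-↑ʳ; toℕ<n; ↑ˡ-injective; ↑ʳ-injective; splitAt⁻¹-↑ˡ; splitAt⁻¹-↑ʳ)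
import Data.Fin.Properties as Fin
open import Data.Nat using (ℕ; zero; suc; _+_; _*_; _∸_; _≤_; _<_; z≤n; s≤s; _<ᵇ_; _≡ᵇ_)
open import Data.Nat.Properties hiding (_≟_)
open import Algebra.Properties.CommutativeSemigroup +-commutativeSemigroup using (interchange)
open import Data.Nat.Solver using (module +-*-Solver)
open import Data.Product using (Σ; ∃; ∃₂; ∃-syntax; _×_; _,_; proj₁; proj₂)
import Data.Product
open import Data.Sum using (_⊎_; inj₁; inj₂)
import Data.Sum
open import Data.Unit using (tt)
open import Data.Vec.Functional using (updateAt)
open import Data.Vec.Functional.Properties using (updateAt-updates; updateAt-minimal)
open import Function using (_∘_; const)
open import Function.Bundles using (Equivalence; _⇔_; mk⇔)
open import Function.Definitions using (Injective)
open import Function.Properties.Equivalence using () renaming (trans to ⇔-trans)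
open import Relation.Binary using (tri<; tri≈; tri>)
open import Relation.Binary.PropositionalEquality
open import Relation.Nullary using (¬_; Dec; yes; no; does; ¬?; _×-dec_)
open import Relation.Nullary.Decidable using (⌊_⌋; toWitness; decidable-stable)

open Equivalence using (to; from)
open +-*-Solver using (solve; _:=_; con; _:+_; _:*_)

does⇒ : ∀ {A : Set} (d : Dec A) → T (does d) → A
does⇒ (yes a) _ = a

does⇐ : ∀ {A : Set} (d : Dec A) → A → T (does d)
does⇐ (yes _)  _ = tt
does⇐ (no ¬a) a = ¬a a

not-does⇒ : ∀ {A : Set} (d : Dec A) → T (not (does d)) → ¬ A
not-does⇒ (no ¬a) _ = ¬a

not-does⇐ : ∀ {A : Set} (d : Dec A) → ¬ A → T (not (does d))
not-does⇐ (yes a) ¬a = ¬a a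
not-does⇐ (no _)  _  = tt

¬T-≡-false : ∀ {b} → ¬ T b → b ≡ false
¬T-≡-false {true}  ¬b = ⊥-elim (¬b tt)
¬T-≡-false {false} _  = refl

indicator : Bool → ℕ
indicator b = if b then 1 else 0

indicator-mono : ∀ {a b} → (T a → T b) → indicator a ≤ indicator b
indicator-mono {false}         _ = z≤n
indicator-mono {true} {true}   _ = ≤-refl
indicator-mono {true} {false} a⇒b = ⊥-elim (a⇒b tt)

sumFin-cong : ∀ {n} {f g : Fin n → ℕ} → (∀ i → f i ≡ g i) → sumFin f ≡ sumFin g
sumFin-cong {zero}  _   = refl
sumFin-cong {suc n} f≗g = cong₂ _+_ (f≗g zero) (sumFin-cong (f≗g ∘ suc))

sumFin-mono : ∀ {n} {f g : Fin n → ℕ} → (∀ i → f i ≤ g i) → sumFin f ≤ sumFin g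
sumFin-mono {zero}  _   = z≤n
sumFin-mono {suc n} f≤g = +-mono-≤ (f≤g zero) (sumFin-mono (f≤g ∘ suc))

sumFin-zero : ∀ n → sumFin {n} (λ _ → 0) ≡ 0
sumFin-zero zero    = refl
sumFin-zero (suc n) = sumFin-zero n

sumFin-+ : ∀ {n} (f g : Fin n → ℕ) → sumFin (λ i → f i + g i) ≡ sumFin f + sumFin g
sumFin-+ {zero}  f g = refl
sumFin-+ {suc n} f g = trans (cong (f zero + g zero +_) (sumFin-+ (f ∘ suc) (g ∘ suc)))
                             (interchange (f zero) (g zero) (sumFin (f ∘ suc)) (sumFin (g ∘ suc)))

sumFin-*ˡ : ∀ {n} c (f : Fin n → ℕ) → sumFin (λ i → c * f i) ≡ c * sumFin f
sumFin-*ˡ {zero}  c f = sym (*-zeroʳ c)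
sumFin-*ˡ {suc n} c f = trans (cong (c * f zero +_) (sumFin-*ˡ c (f ∘ suc)))
                              (sym (*-distribˡ-+ c (f zero) (sumFin (f ∘ suc))))

sumFin-comm : ∀ {m n} (f : Fin m → Fin n → ℕ) →
  sumFin (λ i → sumFin (f i)) ≡ sumFin (λ j → sumFin (λ i → f i j))
sumFin-comm {zero}  {n} f = sym (sumFin-zero n)
sumFin-comm {suc m} {n} f = trans (cong (sumFin (f zero) +_) (sumFin-comm (f ∘ suc)))
                                  (sym (sumFin-+ (f zero) (λ j → sumFin (λ i → f (suc i) j))))

sumFin-mono-≡⇒≗ : ∀ {n} {f g : Fin n → ℕ} → (∀ i → f i ≤ g i) → sumFin f ≡ sumFin g →
  ∀ i → f i ≡ g i
sumFin-mono-≡⇒≗ {suc n} {f} {g} f≤g Σf≡Σg = pointwise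
  where
  head≡ : f zero ≡ g zero
  head≡ = ≤-antisym (f≤g zero) (+-cancelʳ-≤ (sumFin (f ∘ suc)) (g zero) (f zero)
    (begin
      g zero + sumFin (f ∘ suc) ≤⟨ +-monoʳ-≤ (g zero) (sumFin-mono (f≤g ∘ suc)) ⟩
      g zero + sumFin (g ∘ suc) ≡⟨ sym Σf≡Σg ⟩
      f zero + sumFin (f ∘ suc) ∎))
    where open ≤-Reasoning
  pointwise : ∀ i → f i ≡ g i
  pointwise zero    = head≡
  pointwise (suc i) = sumFin-mono-≡⇒≗ (f≤g ∘ suc)
    (+-cancelˡ-≡ (f zero) _ _ (trans Σf≡Σg (cong (_+ sumFin (g ∘ suc)) (sym head≡)))) i

_⊆ᵇ_ : ∀ {n} → (Fin n → Bool) → (Fin n → Bool) → Set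
p ⊆ᵇ q = ∀ i → T (p i) → T (q i)

remove : ∀ {n} → (Fin n → Bool) → Fin n → Fin n → Bool
remove p x y = p y ∧ not (does (y ≟ x))

insert : ∀ {n} → Fin n → (Fin n → Bool) → Fin n → Bool
insert x p y = does (y ≟ x) ∨ p y

image : ∀ {m n} → (Fin m → Fin n) → (Fin m → Bool) → Fin n → Bool
image h p y = does (any? (λ i → T? (p i) ×-dec (y ≟ h i)))

image-intro : ∀ {m n} {h : Fin m → Fin n} {p : Fin m → Bool} {i} → T (p i) → T (image h p (h i))
image-intro {h = h} {p} {i} pi = does⇐ (any? (λ j → T? (p j) ×-dec (h i ≟ h j))) (i , pi , refl)

image-elim : ∀ {m n} {h : Fin m → Fin n} {p : Fin m → Bool} {y} → T (image h p y) → ∃[ i ] (T (p i) × y ≡ h i)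
image-elim {h = h} {p} {y} = does⇒ (any? (λ j → T? (p j) ×-dec (y ≟ h j)))

count-cong : ∀ {n} {p q : Fin n → Bool} → (∀ i → p i ≡ q i) → count p ≡ count q
count-cong p≗q = sumFin-cong (cong indicator ∘ p≗q)

count-mono : ∀ {n} {p q : Fin n → Bool} → p ⊆ᵇ q → count p ≤ count q
count-mono p⊆q = sumFin-mono (λ i → indicator-mono (p⊆q i))

count-⊆-⊇ : ∀ {n} {p q : Fin n → Bool} → p ⊆ᵇ q → q ⊆ᵇ p → count p ≡ count q
count-⊆-⊇ p⊆q q⊆p = ≤-antisym (count-mono p⊆q) (count-mono q⊆p)

count-remove : ∀ {n} (p : Fin n → Bool) x → T (p x) → count p ≡ suc (count (remove p x))
count-remove {suc n} p zero px rewrite T-≡ .to px =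
  cong suc (count-cong (λ i → sym (∧-identityʳ (p (suc i)))))
count-remove {suc n} p (suc x) px = begin
  indicator (p zero) + count (p ∘ suc)                        ≡⟨ cong (indicator (p zero) +_) (count-remove (p ∘ suc) x px) ⟩
  indicator (p zero) + suc (count (remove (p ∘ suc) x))       ≡⟨ +-suc _ _ ⟩
  suc (indicator (p zero) + count (remove (p ∘ suc) x))       ≡⟨ cong (λ b → suc (indicator b + count (remove (p ∘ suc) x))) (sym (∧-identityʳ (p zero))) ⟩
  suc (indicator (p zero ∧ true) + count (remove (p ∘ suc) x)) ∎
  where open ≡-Reasoning

count-insert : ∀ {n} (p : Fin n → Bool) x → ¬ T (p x) → count (insert x p) ≡ suc (count p)
count-insert p x ¬px =
  trans (count-remove (insert x p) x (T-∨ .from (inj₁ (does⇐ (x ≟ x) refl)))) (cong suc (count-⊆-⊇ dropped kept))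
  where
  dropped : remove (insert x p) x ⊆ᵇ p
  dropped y h with y ≟ x
  ... | no _ = subst T (∧-identityʳ (p y)) h
  kept : p ⊆ᵇ remove (insert x p) x
  kept y py with y ≟ x
  ... | yes refl = ⊥-elim (¬px py)
  ... | no _     = subst T (sym (∧-identityʳ (p y))) py

count-true : ∀ n → count {n} (λ _ → true) ≡ n
count-true zero    = refl
count-true (suc n) = cong suc (count-true n)

count-none : ∀ {n} {p : Fin n → Bool} → (∀ i → ¬ T (p i)) → count p ≡ 0
count-none {n} ¬p = n≤0⇒n≡0 (≤-trans (count-mono (λ i pi → ⊥-elim (¬p i pi))) (≤-reflexive (sumFin-zero n)))

count-single : ∀ {n} (x : Fin n) → count (λ y → does (y ≟ x)) ≡ 1
count-single {n} x = begin
  count (λ y → does (y ≟ x))   ≡⟨ count-cong (λ y → sym (∨-identityʳ (does (y ≟ x)))) ⟩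
  count (insert x (λ _ → false)) ≡⟨ count-insert (λ _ → false) x (λ ()) ⟩
  suc (count {n} (λ _ → false))  ≡⟨ cong suc (sumFin-zero n) ⟩
  1                              ∎
  where open ≡-Reasoning

count-image : ∀ {m n} (h : Fin m → Fin n) → Injective _≡_ _≡_ h → (p : Fin m → Bool) →
  count (image h p) ≡ count p
count-image {zero}  {n} h _     p = sumFin-zero n
count-image {suc m}     h h-inj p with p zero in p₀
... | true  = trans (count-insert (image (h ∘ suc) (p ∘ suc)) (h zero) h₀∉)
                    (cong suc (count-image (h ∘ suc) (Fin.suc-injective ∘ h-inj) (p ∘ suc)))
  where
  h₀∉ : ¬ T (image (h ∘ suc) (p ∘ suc) (h zero))
  h₀∉ h₀∈ with image-elim {h = h ∘ suc} h₀∈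
  ... | i , _ , h₀≡ with h-inj h₀≡
  ... | ()
... | false = count-image (h ∘ suc) (Fin.suc-injective ∘ h-inj) (p ∘ suc)

count-injective : ∀ {m n} (h : Fin m → Fin n) → Injective _≡_ _≡_ h → {p : Fin m → Bool} {q : Fin n → Bool} →
  (∀ i → T (p i) → T (q (h i))) → count p ≤ count q
count-injective h h-inj {p} {q} p→q∘h = begin
  count p           ≡⟨ count-image h h-inj p ⟨
  count (image h p) ≤⟨ count-mono image⊆q ⟩
  count q           ∎
  where
  open ≤-Reasoning
  image⊆q : image h p ⊆ᵇ q
  image⊆q y y∈ with image-elim {h = h} y∈
  ... | i , pi , refl = p→q∘h i pi

count-< : ∀ {n} {p q : Fin n → Bool} x → p ⊆ᵇ q → ¬ T (p x) → T (q x) → count p < count q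
count-< {p = p} {q} x p⊆q ¬px qx = begin-strict
  count p             <⟨ s≤s (count-mono p⊆q-x) ⟩
  suc (count (remove q x)) ≡⟨ count-remove q x qx ⟨
  count q             ∎
  where
  open ≤-Reasoning
  p⊆q-x : p ⊆ᵇ remove q x
  p⊆q-x y py with y ≟ x
  ... | yes refl = ⊥-elim (¬px py)
  ... | no _     = subst T (sym (∧-identityʳ (q y))) (p⊆q y py)

count-≥⇒⊇ : ∀ {n} {p q : Fin n → Bool} → p ⊆ᵇ q → count q ≤ count p → q ⊆ᵇ p
count-≥⇒⊇ {p = p} p⊆q q≤p x qx with T? (p x)
... | yes px = px
... | no ¬px = ⊥-elim (<⇒≱ (count-< x p⊆q ¬px qx) q≤p)

count<⇒∃∉ : ∀ {n} (p : Fin n → Bool) → count p < n → ∃[ x ] ¬ T (p x)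
count<⇒∃∉ {suc n} p c<n with p zero in p₀
... | false = zero , λ p0 → subst T p₀ p0
... | true with count<⇒∃∉ (p ∘ suc) (≤-pred c<n)
...   | x , ¬px = suc x , ¬px

count-insert-≤ : ∀ {n} (p : Fin n → Bool) x → count (insert x p) ≤ suc (count p)
count-insert-≤ p x with T? (p x)
... | yes px = ≤-trans (count-mono insert⊆p) (n≤1+n (count p))
  where
  insert⊆p : insert x p ⊆ᵇ p
  insert⊆p y h with y ≟ x
  ... | yes refl = px
  ... | no _     = h
... | no ¬px = ≤-reflexive (count-insert p x ¬px)

∉insert⇒≢ : ∀ {n} x (p : Fin n → Bool) y → ¬ T (insert x p y) → y ≢ x
∉insert⇒≢ _ _ y y∉ refl with y ≟ y
... | yes _  = y∉ tt
... | no y≢y = y≢y refl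

∉insert⇒∉ : ∀ {n} x (p : Fin n → Bool) y → ¬ T (insert x p y) → ¬ T (p y)
∉insert⇒∉ x _ y y∉ py with y ≟ x
... | yes _ = y∉ tt
... | no _  = y∉ py

count-all-but-one : ∀ {n} (a : Fin n) → suc (count (remove (λ _ → true) a)) ≡ n
count-all-but-one {n} a = trans (sym (count-remove (λ _ → true) a tt)) (count-true n)

count-all-but-two : ∀ {n} {a b : Fin n} → b ≢ a →
  suc (suc (count (remove (remove (λ _ → true) a) b))) ≡ n
count-all-but-two {a = a} {b} b≢a =
  trans (cong suc (sym (count-remove (remove (λ _ → true) a) b (not-does⇐ (b ≟ a) b≢a)))) (count-all-but-one a)

count-all-but-three : ∀ {n} {a b c : Fin n} → b ≢ a → c ≢ a → c ≢ b →
  suc (suc (suc (count (remove (remove (remove (λ _ → true) a) b) c)))) ≡ n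
count-all-but-three {a = a} {b} {c} b≢a c≢a c≢b =
  trans (cong (λ c → suc (suc c)) (sym (count-remove (remove (remove (λ _ → true) a) b) c
    (T-∧ {not (does (c ≟ a))} .from (not-does⇐ (c ≟ a) c≢a , not-does⇐ (c ≟ b) c≢b)))))
    (count-all-but-two b≢a)

IsCliqueIn : ∀ {n t} → Adjacency n → (Fin t → Fin n) → Set
IsCliqueIn a f = Injective _≡_ _≡_ f × (∀ i j → i ≢ j → T (a (f i) (f j)))

record Virus {n} (t : ℕ) (a : Adjacency n) : Set where
  field
    core        : Fin t → Fin n
    core-clique : IsCliqueIn a core
    p q         : Fin t
    p≢q         : p ≢ q
    x y         : Fin n
    x∉core      : ∀ i → core i ≢ x
    y∉core      : ∀ i → core i ≢ y
    x≢y         : x ≢ y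
    px          : T (a (core p) x)
    qy          : T (a (core q) y)

data Position (t : ℕ) : Fin (t + 2) → Set where
  inCore    : (i : Fin t) → Position t (i ↑ˡ 2)
  inPendant : (r : Fin 2) → Position t (t ↑ʳ r)

position : ∀ t k → Position t k
position t k with splitAt t k in split
... | inj₁ i = subst (Position t) (splitAt⁻¹-↑ˡ split) (inCore i)
... | inj₂ r = subst (Position t) (splitAt⁻¹-↑ʳ split) (inPendant r)

VirusEdge : ∀ t → Fin (t + 2) → Fin (t + 2) → Set
VirusEdge t k l =
  (toℕ k ≢ toℕ l × toℕ k < t × toℕ l < t)
  ⊎ (toℕ k ≡ t × toℕ l ≡ 0) ⊎ (toℕ l ≡ t × toℕ k ≡ 0)
  ⊎ (toℕ k ≡ suc t × toℕ l ≡ 1) ⊎ (toℕ l ≡ suc t × toℕ k ≡ 1)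

≢ᵇ⇒≢ : ∀ a b → T (if a ≡ᵇ b then false else true) → a ≢ b
≢ᵇ⇒≢ a b h a≡b with a ≡ᵇ b | ≡⇒≡ᵇ a b a≡b
... | true | _ = h

≢⇒≢ᵇ : ∀ a b → a ≢ b → T (if a ≡ᵇ b then false else true)
≢⇒≢ᵇ a b a≢b with a ≡ᵇ b in eq
... | true  = a≢b (≡ᵇ⇒≡ a b (subst T (sym eq) tt))
... | false = tt

≡ᵇ-pair : ∀ {a b c d} → T ((a ≡ᵇ b) ∧ (c ≡ᵇ d)) → a ≡ b × c ≡ d
≡ᵇ-pair h = let (u , v) = T-∧ .to h in ≡ᵇ⇒≡ _ _ u , ≡ᵇ⇒≡ _ _ v

virusAdj⇒VirusEdge : ∀ t k l → T (virusAdj t k l) → VirusEdge t k l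
virusAdj⇒VirusEdge t k l e with T-∨ .to e
... | inj₁ c = let (k≢l , k<t,l<t) = T-∧ .to c ; (k<t , l<t) = T-∧ .to k<t,l<t in
               inj₁ (≢ᵇ⇒≢ (toℕ k) (toℕ l) k≢l , <ᵇ⇒< _ _ k<t , <ᵇ⇒< _ _ l<t)
... | inj₂ e₁ with T-∨ .to e₁
...   | inj₁ c = inj₂ (inj₁ (≡ᵇ-pair c))
...   | inj₂ e₂ with T-∨ .to e₂
...     | inj₁ c = inj₂ (inj₂ (inj₁ (≡ᵇ-pair c)))
...     | inj₂ e₃ with T-∨ .to e₃
...       | inj₁ c = inj₂ (inj₂ (inj₂ (inj₁ (≡ᵇ-pair c))))
...       | inj₂ c = inj₂ (inj₂ (inj₂ (inj₂ (≡ᵇ-pair c))))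

≡ᵇ-pair⁻¹ : ∀ {a b c d} → a ≡ b × c ≡ d → T ((a ≡ᵇ b) ∧ (c ≡ᵇ d))
≡ᵇ-pair⁻¹ (a≡b , c≡d) = T-∧ .from (≡⇒≡ᵇ _ _ a≡b , ≡⇒≡ᵇ _ _ c≡d)

core-disjunct : ∀ {t a b} → a ≢ b × a < t × b < t →
  T ((if a ≡ᵇ b then false else true) ∧ (a <ᵇ t) ∧ (b <ᵇ t))
core-disjunct (a≢b , a<t , b<t) = T-∧ .from (≢⇒≢ᵇ _ _ a≢b , T-∧ .from (<⇒<ᵇ a<t , <⇒<ᵇ b<t))

∨₅-from : ∀ a b c d e → T a ⊎ T b ⊎ T c ⊎ T d ⊎ T e → T (a ∨ b ∨ c ∨ d ∨ e)
∨₅-from true  _     _     _     _ _                        = tt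
∨₅-from false true  _     _     _ _                        = tt
∨₅-from false false true  _     _ _                        = tt
∨₅-from false false false true  _ _                        = tt
∨₅-from false false false false _ (inj₂ (inj₂ (inj₂ (inj₂ te)))) = te
∨₅-from false false false false _ (inj₁ ())
∨₅-from false false false false _ (inj₂ (inj₁ ()))
∨₅-from false false false false _ (inj₂ (inj₂ (inj₁ ())))
∨₅-from false false false false _ (inj₂ (inj₂ (inj₂ (inj₁ ()))))

VirusEdge⇒virusAdj : ∀ t k l → VirusEdge t k l → T (virusAdj t k l)
VirusEdge⇒virusAdj t k l e = ∨₅-from _ _ _ _ _
  (Data.Sum.map core-disjunct (Data.Sum.map ≡ᵇ-pair⁻¹ (Data.Sum.map ≡ᵇ-pair⁻¹
    (Data.Sum.map ≡ᵇ-pair⁻¹ ≡ᵇ-pair⁻¹))) e)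

VirusEdge-sym : ∀ {t k l} → VirusEdge t k l → VirusEdge t l k
VirusEdge-sym (inj₁ (k≢l , k<t , l<t))      = inj₁ ((k≢l ∘ sym) , l<t , k<t)
VirusEdge-sym (inj₂ (inj₁ e))               = inj₂ (inj₂ (inj₁ e))
VirusEdge-sym (inj₂ (inj₂ (inj₁ e)))        = inj₂ (inj₁ e)
VirusEdge-sym (inj₂ (inj₂ (inj₂ (inj₁ e)))) = inj₂ (inj₂ (inj₂ (inj₂ e)))
VirusEdge-sym (inj₂ (inj₂ (inj₂ (inj₂ e)))) = inj₂ (inj₂ (inj₂ (inj₁ e)))

transpose-here : ∀ {m} (i j : Fin m) → transpose i j i ≡ j
transpose-here i j with i ≟ i
... | yes _  = refl
... | no i≢i = ⊥-elim (i≢i refl)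

transpose-other : ∀ {m} {i j k : Fin m} → k ≢ i → k ≢ j → transpose i j k ≡ k
transpose-other {i = i} {j} {k} k≢i k≢j with k ≟ i
... | yes k≡i = ⊥-elim (k≢i k≡i)
... | no _ with k ≟ j
...   | yes k≡j = ⊥-elim (k≢j k≡j)
...   | no _    = refl

transpose-injective : ∀ {m} (i j : Fin m) → Injective _≡_ _≡_ (transpose i j)
transpose-injective i j {k} {l} e =
  trans (sym (transpose-inverse j i)) (trans (cong (transpose j i) e) (transpose-inverse j i))

module _ {t′ : ℕ} where
  private
    t : ℕ
    t = suc (suc t′)
    i₀ i₁ : Fin t
    i₀ = zero
    i₁ = suc zero

  core<t : ∀ (i : Fin t) → toℕ (i ↑ˡ 2) < t
  core<t i = subst (_< t) (sym (toℕ-↑ˡ i 2)) (toℕ<n i)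

  t≤pendant : ∀ (r : Fin 2) → t ≤ toℕ (t ↑ʳ r)
  t≤pendant r = subst (t ≤_) (sym (toℕ-↑ʳ t r)) (m≤m+n t (toℕ r))

  core≢t : ∀ (i : Fin t) → toℕ (i ↑ˡ 2) ≢ t
  core≢t i = <⇒≢ (core<t i)

  core≢1+t : ∀ (i : Fin t) → toℕ (i ↑ˡ 2) ≢ suc t
  core≢1+t i = <⇒≢ (<-trans (core<t i) (n<1+n t))

  pendant-index₀ : ∀ (r : Fin 2) → toℕ (t ↑ʳ r) ≡ t → r ≡ zero
  pendant-index₀ r e =
    toℕ-injective (+-cancelˡ-≡ t (toℕ r) 0 (trans (sym (toℕ-↑ʳ t r)) (trans e (sym (+-identityʳ t)))))

  pendant-index₁ : ∀ (r : Fin 2) → toℕ (t ↑ʳ r) ≡ suc t → r ≡ suc zero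
  pendant-index₁ r e =
    toℕ-injective (+-cancelˡ-≡ t (toℕ r) 1 (trans (sym (toℕ-↑ʳ t r)) (trans e (+-comm 1 t))))

  core-core : ∀ {i j} → T (virusAdj t (i ↑ˡ 2) (j ↑ˡ 2)) → i ≢ j
  core-core {i} {j} e with virusAdj⇒VirusEdge t _ _ e
  ... | inj₁ (k≢l , _)                      = k≢l ∘ cong (toℕ ∘ (_↑ˡ 2))
  ... | inj₂ (inj₁ (k≡t , _))               = ⊥-elim (core≢t i k≡t)
  ... | inj₂ (inj₂ (inj₁ (l≡t , _)))        = ⊥-elim (core≢t j l≡t)
  ... | inj₂ (inj₂ (inj₂ (inj₁ (k≡1+t , _)))) = ⊥-elim (core≢1+t i k≡1+t)
  ... | inj₂ (inj₂ (inj₂ (inj₂ (l≡1+t , _)))) = ⊥-elim (core≢1+t j l≡1+t)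

  core-pendant : ∀ {i r} → VirusEdge t (i ↑ˡ 2) (t ↑ʳ r) →
    (i ≡ zero × r ≡ zero) ⊎ (i ≡ suc zero × r ≡ suc zero)
  core-pendant {i} {r} (inj₁ (_ , _ , l<t))   = ⊥-elim (<⇒≱ l<t (t≤pendant r))
  core-pendant {i} (inj₂ (inj₁ (k≡t , _)))   = ⊥-elim (core≢t i k≡t)
  core-pendant {i} {r} (inj₂ (inj₂ (inj₁ (l≡t , k≡0)))) =
    inj₁ (toℕ-injective (trans (sym (toℕ-↑ˡ i 2)) k≡0) , pendant-index₀ r l≡t)
  core-pendant {i} (inj₂ (inj₂ (inj₂ (inj₁ (k≡1+t , _))))) = ⊥-elim (core≢1+t i k≡1+t)
  core-pendant {i} {r} (inj₂ (inj₂ (inj₂ (inj₂ (l≡1+t , k≡1))))) =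
    inj₂ (toℕ-injective (trans (sym (toℕ-↑ˡ i 2)) k≡1) , pendant-index₁ r l≡1+t)

  ¬pendant-pendant : ∀ {r s} → ¬ VirusEdge t (t ↑ʳ r) (t ↑ʳ s)
  ¬pendant-pendant {r} (inj₁ (_ , k<t , _)) = <⇒≱ k<t (t≤pendant r)
  ¬pendant-pendant {r} {s} (inj₂ (inj₁ (_ , l≡0))) with subst (t ≤_) l≡0 (t≤pendant s)
  ... | ()
  ¬pendant-pendant {r} (inj₂ (inj₂ (inj₁ (_ , k≡0)))) with subst (t ≤_) k≡0 (t≤pendant r)
  ... | ()
  ¬pendant-pendant {r} {s} (inj₂ (inj₂ (inj₂ (inj₁ (_ , l≡1))))) with subst (t ≤_) l≡1 (t≤pendant s)
  ... | s≤s ()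
  ¬pendant-pendant {r} (inj₂ (inj₂ (inj₂ (inj₂ (_ , k≡1))))) with subst (t ≤_) k≡1 (t≤pendant r)
  ... | s≤s ()

  core≢pendant : ∀ (i : Fin t) (r : Fin 2) → i ↑ˡ 2 ≢ t ↑ʳ r
  core≢pendant i r e = <⇒≱ (core<t i) (subst (λ k → t ≤ toℕ k) (sym e) (t≤pendant r))

  virusAdj-core : ∀ {i j : Fin t} → i ≢ j → T (virusAdj t (i ↑ˡ 2) (j ↑ˡ 2))
  virusAdj-core {i} {j} i≢j =
    VirusEdge⇒virusAdj t (i ↑ˡ 2) (j ↑ˡ 2) (inj₁ (i≢j ∘ ↑ˡ-injective 2 i j ∘ toℕ-injective , core<t i , core<t j))

  virusAdj-pendant₀ : T (virusAdj t (i₀ ↑ˡ 2) (t ↑ʳ zero))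
  virusAdj-pendant₀ =
    VirusEdge⇒virusAdj t (i₀ ↑ˡ 2) (t ↑ʳ zero) (inj₂ (inj₂ (inj₁ (trans (toℕ-↑ʳ t zero) (+-identityʳ t) , refl))))

  virusAdj-pendant₁ : T (virusAdj t (i₁ ↑ˡ 2) (t ↑ʳ suc zero))
  virusAdj-pendant₁ =
    VirusEdge⇒virusAdj t (i₁ ↑ˡ 2) (t ↑ʳ suc zero) (inj₂ (inj₂ (inj₂ (inj₂ (trans (toℕ-↑ʳ t (suc zero)) (+-comm t 1) , refl)))))

  contains⇒virus : ∀ {n} {a : Adjacency n} → Contains a (virusAdj t) → Virus t a
  contains⇒virus (h , h-inj , h-adj) = record
    { core        = λ i → h (i ↑ˡ 2)
    ; core-clique = ↑ˡ-injective 2 _ _ ∘ h-inj , λ i j i≢j → h-adj _ _ (virusAdj-core i≢j)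
    ; p = i₀ ; q = i₁ ; p≢q = λ ()
    ; x = h (t ↑ʳ zero) ; y = h (t ↑ʳ suc zero)
    ; x∉core = λ i → core≢pendant i zero ∘ h-inj
    ; y∉core = λ i → core≢pendant i (suc zero) ∘ h-inj
    ; x≢y    = (λ ()) ∘ ↑ʳ-injective t zero (suc zero) ∘ h-inj
    ; px = h-adj (i₀ ↑ˡ 2) (t ↑ʳ zero) virusAdj-pendant₀
    ; qy = h-adj (i₁ ↑ˡ 2) (t ↑ʳ suc zero) virusAdj-pendant₁
    }

  embed : ∀ {n} → (Fin t → Fin n) → Fin n → Fin n → Fin (t + 2) → Fin n
  embed {n} g x y k = place (position t k)
    where
    place : ∀ {k} → Position t k → Fin n
    place (inCore i)             = g i
    place (inPendant zero)       = x
    place (inPendant (suc zero)) = y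

  module _ {n} {a : Adjacency n} (a-sym : ∀ u v → T (a u v) → T (a v u))
           {g : Fin t → Fin n} (g-clique : IsCliqueIn a g) {x y : Fin n}
           (x∉g : ∀ i → g i ≢ x) (y∉g : ∀ i → g i ≢ y) (x≢y : x ≢ y) where

    embed-injective : ∀ {k l} → embed g x y k ≡ embed g x y l → k ≡ l
    embed-injective {k} {l} e with position t k | position t l
    ... | inCore i             | inCore j             = cong (_↑ˡ 2) (proj₁ g-clique e)
    ... | inCore i             | inPendant zero       = ⊥-elim (x∉g i e)
    ... | inCore i             | inPendant (suc zero) = ⊥-elim (y∉g i e)
    ... | inPendant zero       | inCore j             = ⊥-elim (x∉g j (sym e))
    ... | inPendant (suc zero) | inCore j             = ⊥-elim (y∉g j (sym e))
    ... | inPendant zero       | inPendant zero       = refl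
    ... | inPendant zero       | inPendant (suc zero) = ⊥-elim (x≢y e)
    ... | inPendant (suc zero) | inPendant zero       = ⊥-elim (x≢y (sym e))
    ... | inPendant (suc zero) | inPendant (suc zero) = refl

    embed-adj : T (a (g i₀) x) → T (a (g i₁) y) →
      ∀ k l → T (virusAdj t k l) → T (a (embed g x y k) (embed g x y l))
    embed-adj g₀x g₁y k l e with position t k | position t l
    ... | inCore i | inCore j = proj₂ g-clique i j (core-core e)
    ... | inCore i | inPendant r with core-pendant {i} {r} (virusAdj⇒VirusEdge t _ _ e)
    ...   | inj₁ (refl , refl) = g₀x
    ...   | inj₂ (refl , refl) = g₁y
    embed-adj g₀x g₁y k l e | inPendant r | inCore j
      with core-pendant {j} {r} (VirusEdge-sym (virusAdj⇒VirusEdge t _ _ e))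
    ...   | inj₁ (refl , refl) = a-sym _ _ g₀x
    ...   | inj₂ (refl , refl) = a-sym _ _ g₁y
    embed-adj g₀x g₁y k l e | inPendant r | inPendant s =
      ⊥-elim (¬pendant-pendant (virusAdj⇒VirusEdge t _ _ e))

  virus⇒contains : ∀ {n} {a : Adjacency n} → (∀ u v → T (a u v) → T (a v u)) →
    Virus t a → Contains a (virusAdj t)
  virus⇒contains {a = a} a-sym v =
    embed g x y ,
    embed-injective a-sym g-clique (x∉core ∘ σ) (y∉core ∘ σ) x≢y ,
    embed-adj a-sym g-clique (x∉core ∘ σ) (y∉core ∘ σ) x≢y
      (subst (λ i → T (a (core i) x)) (sym σ₀) px) (subst (λ i → T (a (core i) y)) (sym σ₁) qy)
    where
    open Virus v
    -- σ moves the pendant indices p and q to 0 and 1, where virusAdj attaches its pendants.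
    q′ : Fin t
    q′ = transpose p zero q
    σ : Fin t → Fin t
    σ = transpose zero p ∘ transpose (suc zero) q′
    σ-injective : Injective _≡_ _≡_ σ
    σ-injective = transpose-injective (suc zero) q′ ∘ transpose-injective zero p
    g : Fin t → Fin _
    g = core ∘ σ
    g-clique : IsCliqueIn a g
    g-clique = σ-injective ∘ proj₁ core-clique , λ i j i≢j → proj₂ core-clique (σ i) (σ j) (i≢j ∘ σ-injective)
    σ₀ : σ zero ≡ p
    σ₀ = trans (cong (transpose zero p) (transpose-other {i = suc zero} {q′} (λ ()) q′≢0)) (transpose-here zero p)
      where
      q′≢0 : zero ≢ q′
      q′≢0 0≡q′ = p≢q (trans (sym (transpose-here zero p)) (trans (cong (transpose zero p) 0≡q′) (transpose-inverse zero p)))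
    σ₁ : σ (suc zero) ≡ q
    σ₁ = trans (cong (transpose zero p) (transpose-here (suc zero) q′)) (transpose-inverse zero p)

module _ {n} {G : Graph n} where

  length : ∀ {P u v} → Walk G P u v → ℕ
  length (here _)          = 0
  length (step _ _ rest)   = suc (length rest)

  walk-exit : ∀ {P u v} → Walk G P u v → (S : Fin n → Bool) → T (S u) → ¬ T (S v) →
    ∃₂ λ p q → P p × T (S p) × ¬ T (S q) × T (adj G p q)
  walk-exit (here _) S Su ¬Sv = ⊥-elim (¬Sv Su)
  walk-exit (step {u} {v} Pu uv rest) S Su ¬Sw with T? (S v)
  ... | yes Sv = walk-exit rest S Sv ¬Sw
  ... | no ¬Sv = u , v , Pu , Su , ¬Sv , uv

  record Pocket (del : Fin n → Bool) (x : Fin n) : Set where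
    field
      inside     : Fin n → Bool
      gate       : Fin n
      x-inside   : T (inside x)
      inside⊆del : inside ⊆ᵇ del
      gate-kept  : ¬ T (del gate)
      closed     : ∀ z y → T (inside z) → T (adj G z y) → T (inside y) ⊎ y ≡ gate

  module _ {del : Fin n → Bool} where

    leave-pocket : ∀ {x P z v} (b : Pocket del x) (w : Walk G P z v) →
      T (Pocket.inside b z) → ¬ T (Pocket.inside b v) →
      Σ (Walk G P (Pocket.gate b) v) λ w′ → length w′ < length w
    leave-pocket b (here _) z∈ v∉ = ⊥-elim (v∉ z∈)
    leave-pocket b (step {z} {z′} _ zz′ rest) z∈ v∉ with Pocket.closed b z z′ z∈ zz′
    ... | inj₂ refl = rest , ≤-refl
    ... | inj₁ z′∈ with leave-pocket b rest z′∈ v∉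
    ...   | w′ , shorter = w′ , ≤-trans shorter (n≤1+n _)

    Kept : Fin n → Set
    Kept x = del x ≡ false

    private
      kept⇒∉ : ∀ {x y} (b : Pocket del x) → Kept y → ¬ T (Pocket.inside b y)
      kept⇒∉ b kept y∈ = subst T kept (Pocket.inside⊆del b _ y∈)

    module _ (pocket : ∀ x → T (del x) → Pocket del x) where

      -- A walk entering a pocket leaves it only through the gate, which is where it came from; the
      -- shortcut is not a structural subterm of the walk, hence the fuel.
      reroute : ∀ fuel {P u v} (w : Walk G P u v) → length w ≤ fuel → Kept u → Kept v → Walk G Kept u v
      reroute _ (here _) _ ku _ = here ku
      reroute (suc fuel) (step {u} {x} _ ux rest) (s≤s |rest|≤fuel) ku kv with T? (del x)
      ... | no ¬dx = step ku ux (reroute fuel rest |rest|≤fuel (¬T-≡-false ¬dx) kv)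
      ... | yes dx with Pocket.closed (pocket x dx) x u (Pocket.x-inside (pocket x dx)) (subst T (Graph.sym G u x) ux)
      ...   | inj₁ u∈ = ⊥-elim (kept⇒∉ (pocket x dx) ku u∈)
      ...   | inj₂ refl with leave-pocket (pocket x dx) rest (Pocket.x-inside (pocket x dx)) (kept⇒∉ (pocket x dx) kv)
      ...     | w′ , shorter = reroute fuel w′ (≤-trans (<⇒≤ shorter) |rest|≤fuel) ku kv

      connectedOn-kept : Connected G → ConnectedOn G Kept
      connectedOn-kept connected u v ku kv = reroute _ (connected u v) ≤-refl ku kv

degreeSumIn : ∀ {n} → Graph n → (Fin n → Bool) → ℕ
degreeSumIn G keep = sumFin (λ i → count (λ j → keep i ∧ keep j ∧ adj G i j))

<ᵇ-one-way : ∀ a b → a ≢ b → indicator (a <ᵇ b) + indicator (b <ᵇ a) ≡ 1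
<ᵇ-one-way a b a≢b with <-cmp a b
... | tri< a<b _ _ rewrite T-≡ .to (<⇒<ᵇ a<b) | ¬T-≡-false (<⇒≯ a<b ∘ <ᵇ⇒< b a) = refl
... | tri≈ _ a≡b _ = ⊥-elim (a≢b a≡b)
... | tri> _ _ b<a rewrite T-≡ .to (<⇒<ᵇ b<a) | ¬T-≡-false (<⇒≯ b<a ∘ <ᵇ⇒< a b) = refl

indicator-orient : ∀ kᵢ kⱼ e e′ oᵢⱼ oⱼᵢ → e ≡ e′ → (T e → indicator oᵢⱼ + indicator oⱼᵢ ≡ 1) →
  indicator (kᵢ ∧ kⱼ ∧ e ∧ oᵢⱼ) + indicator (kⱼ ∧ kᵢ ∧ e′ ∧ oⱼᵢ) ≡ indicator (kᵢ ∧ kⱼ ∧ e)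
indicator-orient true  true  true  _ _ _ refl one = one _
indicator-orient true  true  false _ _ _ refl _   = refl
indicator-orient true  false _     _ _ _ refl _   = refl
indicator-orient false true  _     _ _ _ refl _   = refl
indicator-orient false false _     _ _ _ refl _   = refl

handshake : ∀ {n} (G : Graph n) keep → 2 * edgesIn G keep ≡ degreeSumIn G keep
handshake G keep = begin
  2 * Σ-below                                                    ≡⟨ cong (Σ-below +_) (+-identityʳ Σ-below) ⟩
  Σ-below + Σ-below                                              ≡⟨ cong (Σ-below +_) (sumFin-comm below) ⟩
  Σ-below + sumFin (λ i → sumFin (λ j → below j i))              ≡⟨ sumFin-+ (λ i → sumFin (below i)) (λ i → sumFin (λ j → below j i)) ⟨
  sumFin (λ i → sumFin (below i) + sumFin (λ j → below j i))     ≡⟨ sumFin-cong (λ i → sumFin-+ (below i) (λ j → below j i)) ⟨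
  sumFin (λ i → sumFin (λ j → below i j + below j i))            ≡⟨ sumFin-cong (λ i → sumFin-cong (λ j → both-orders i j)) ⟩
  degreeSumIn G keep                                             ∎
  where
  open ≡-Reasoning
  below : Fin _ → Fin _ → ℕ
  below i j = indicator (keep i ∧ keep j ∧ adj G i j ∧ (toℕ i <ᵇ toℕ j))
  Σ-below : ℕ
  Σ-below = sumFin (λ i → sumFin (below i))
  both-orders : ∀ i j → below i j + below j i ≡ indicator (keep i ∧ keep j ∧ adj G i j)
  both-orders i j = indicator-orient (keep i) (keep j) (adj G i j) (adj G j i) _ _ (Graph.sym G i j)
    (λ e → <ᵇ-one-way (toℕ i) (toℕ j) λ i≡j → subst T (Graph.irrefl G i) (subst (λ k → T (adj G i k)) (sym (toℕ-injective i≡j)) e))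

lostDegree : ∀ {n} → Graph n → (Fin n → Bool) → Fin n → ℕ
lostDegree G del x = count (λ y → del x ∧ adj G x y) + count (λ y → del x ∧ not (del y) ∧ adj G x y)

indicator-by-deletion : ∀ dᵢ dⱼ e →
  indicator e ≡ indicator (not dᵢ ∧ not dⱼ ∧ e) + (indicator (dᵢ ∧ e) + indicator (not dᵢ ∧ dⱼ ∧ e))
indicator-by-deletion true  _     true  = refl
indicator-by-deletion true  _     false = refl
indicator-by-deletion false true  true  = refl
indicator-by-deletion false true  false = refl
indicator-by-deletion false false true  = refl
indicator-by-deletion false false false = refl

edges-after-deletion : ∀ {n} (G : Graph n) (del : Fin n → Bool) →
  2 * edges G ≡ 2 * edgesIn G (not ∘ del) + sumFin (lostDegree G del)
edges-after-deletion G del = begin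
  2 * edges G                                                   ≡⟨ handshake G (λ _ → true) ⟩
  degreeSumIn G (λ _ → true)                                    ≡⟨ sumFin-cong (λ i → sumFin-cong (λ j →
                                                                     indicator-by-deletion (del i) (del j) (adj G i j))) ⟩
  sumFin (λ i → sumFin (λ j → kept i j + (lost i j + cut i j)))  ≡⟨ sumFin-cong (λ i → trans (sumFin-+ (kept i) _)
                                                                     (cong (sumFin (kept i) +_) (sumFin-+ (lost i) (cut i)))) ⟩
  sumFin (λ i → sumFin (kept i) + (sumFin (lost i) + sumFin (cut i)))
                                                                ≡⟨ trans (sumFin-+ (sumFin ∘ kept) _)
                                                                     (cong (degreeSumIn G (not ∘ del) +_)
                                                                       (sumFin-+ (sumFin ∘ lost) (sumFin ∘ cut))) ⟩
  degreeSumIn G (not ∘ del) + (ΣΣ lost + ΣΣ cut)                  ≡⟨ cong (degreeSumIn G (not ∘ del) +_) (trans (cong (ΣΣ lost +_) cut-transposed)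
                                                                     (sym (sumFin-+ (sumFin ∘ lost) _))) ⟩
  degreeSumIn G (not ∘ del) + sumFin (lostDegree G del)         ≡⟨ cong (_+ sumFin (lostDegree G del)) (handshake G (not ∘ del)) ⟨
  2 * edgesIn G (not ∘ del) + sumFin (lostDegree G del)         ∎
  where
  open ≡-Reasoning
  kept lost cut : Fin _ → Fin _ → ℕ
  kept i j = indicator (not (del i) ∧ not (del j) ∧ adj G i j)
  lost i j = indicator (del i ∧ adj G i j)
  cut  i j = indicator (not (del i) ∧ del j ∧ adj G i j)
  ΣΣ : (Fin _ → Fin _ → ℕ) → ℕ
  ΣΣ f = sumFin (λ i → sumFin (f i))
  cut-transposed : ΣΣ cut ≡ sumFin (λ x → count (λ y → del x ∧ not (del y) ∧ adj G x y))
  cut-transposed = trans (sumFin-comm cut) (sumFin-cong (λ j → sumFin-cong (λ i → swap (del i) (del j) (Graph.sym G i j))))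
    where
    swap : ∀ dᵢ dⱼ {e e′} → e ≡ e′ → indicator (not dᵢ ∧ dⱼ ∧ e) ≡ indicator (dⱼ ∧ not dᵢ ∧ e′)
    swap true  true  refl = refl
    swap true  false refl = refl
    swap false true  refl = refl
    swap false false refl = refl

count-transfer : ∀ {n} (R : Fin n → Fin n → Bool) → (∀ x y → R x y ≡ R y x) → (h : Fin n → Bool) →
  sumFin (λ x → count (λ y → R x y ∧ h y)) ≡ sumFin (λ x → count (λ y → R x y ∧ h x))
count-transfer R R-sym h = trans (sumFin-comm (λ x y → indicator (R x y ∧ h y)))
  (sumFin-cong (λ y → sumFin-cong (λ x → cong (λ b → indicator (b ∧ h y)) (R-sym x y))))

discharging : ∀ {n} (c φ a b : Fin n → ℕ) → sumFin a ≡ sumFin b → (∀ x → c x + b x ≤ φ x + a x) →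
  sumFin c ≤ sumFin φ × (sumFin c ≡ sumFin φ ⇔ (∀ x → c x + b x ≡ φ x + a x))
discharging c φ a b Σa≡Σb c+b≤φ+a = Σc≤Σφ , mk⇔ tight⇒pointwise pointwise⇒tight
  where
  Σc+b≡ : sumFin (λ x → c x + b x) ≡ sumFin c + sumFin a
  Σc+b≡ = trans (sumFin-+ c b) (cong (sumFin c +_) (sym Σa≡Σb))
  Σc≤Σφ : sumFin c ≤ sumFin φ
  Σc≤Σφ = +-cancelʳ-≤ (sumFin a) (sumFin c) (sumFin φ)
    (subst₂ _≤_ Σc+b≡ (sumFin-+ φ a) (sumFin-mono c+b≤φ+a))
  tight⇒pointwise : sumFin c ≡ sumFin φ → ∀ x → c x + b x ≡ φ x + a x
  tight⇒pointwise Σc≡Σφ = sumFin-mono-≡⇒≗ c+b≤φ+a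
    (trans Σc+b≡ (trans (cong (_+ sumFin a) Σc≡Σφ) (sym (sumFin-+ φ a))))
  pointwise⇒tight : (∀ x → c x + b x ≡ φ x + a x) → sumFin c ≡ sumFin φ
  pointwise⇒tight c+b≡φ+a = +-cancelʳ-≡ (sumFin a) (sumFin c) (sumFin φ)
    (trans (sym Σc+b≡) (trans (sumFin-cong c+b≡φ+a) (sumFin-+ φ a)))

adj-sym : ∀ {n} {G : Graph n} {x y} → T (adj G x y) → T (adj G y x)
adj-sym {G = G} {x} {y} = subst T (Graph.sym G x y)

adj⇒≢ : ∀ {n} {G : Graph n} {x y} → T (adj G x y) → x ≢ y
adj⇒≢ {G = G} {x} xy refl = subst T (Graph.irrefl G x) xy

Outside : ∀ {m n} → (Fin m → Fin n) → Fin n → Set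
Outside f y = ∀ i → f i ≢ y

V[_] : ∀ {m n} → (Fin m → Fin n) → Fin n → Bool
V[ f ] = image f (λ _ → true)

V[_∖_] : ∀ {m n} → (Fin m → Fin n) → Fin m → Fin n → Bool
V[ f ∖ j ] = image f (remove (λ _ → true) j)

module VertexSet {m n} (f : Fin m → Fin n) where

  ∈V : ∀ {i} → T (V[ f ] (f i))
  ∈V {i} = image-intro {h = f} {p = λ _ → true} {i} tt

  V-elim : ∀ {y} → T (V[ f ] y) → ∃[ i ] y ≡ f i
  V-elim y∈ with image-elim {h = f} y∈
  ... | i , _ , y≡ = i , y≡

  Outside⇒∉V : ∀ {y} → Outside f y → ¬ T (V[ f ] y)
  Outside⇒∉V out y∈ with V-elim y∈
  ... | i , y≡fi = out i (sym y≡fi)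

  ∉V⇒Outside : ∀ {y} → ¬ T (V[ f ] y) → Outside f y
  ∉V⇒Outside y∉ i refl = y∉ ∈V

  ∈V∖ : ∀ {i j} → i ≢ j → T (V[ f ∖ j ] (f i))
  ∈V∖ {i} {j} i≢j = image-intro {p = remove (λ _ → true) j} (not-does⇐ (i ≟ j) i≢j)

  V∖-elim : ∀ {j y} → T (V[ f ∖ j ] y) → ∃[ i ] (i ≢ j × y ≡ f i)
  V∖-elim {j} y∈ with image-elim {h = f} y∈
  ... | i , i≢j , y≡ = i , not-does⇒ (i ≟ j) i≢j , y≡

  V∖⊆V : ∀ {j} → V[ f ∖ j ] ⊆ᵇ V[ f ]
  V∖⊆V y y∈ with V∖-elim y∈
  ... | i , _ , refl = ∈V

module Clique {t′ n} {G : Graph n} {f : Fin (suc t′) → Fin n} (kt : IsKt (suc t′) G f) where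

  open VertexSet f public

  injective = proj₁ kt
  edge = proj₂ kt

  count-V∖ : ∀ j → count V[ f ∖ j ] ≡ t′
  count-V∖ j = trans (count-image f injective (remove (λ _ → true) j))
    (suc-injective (trans (sym (count-remove (λ _ → true) j tt)) (count-true (suc t′))))

  V∖⊆N : ∀ j → V[ f ∖ j ] ⊆ᵇ adj G (f j)
  V∖⊆N j y y∈ with V∖-elim y∈
  ... | i , i≢j , refl = edge j i (i≢j ∘ sym)

  V∖+exit⊆N : ∀ {j v} → T (adj G (f j) v) → insert v V[ f ∖ j ] ⊆ᵇ adj G (f j)
  V∖+exit⊆N {j} {v} jv y h with y ≟ v
  ... | yes refl = jv
  ... | no _     = V∖⊆N j y h

  count-V∖+exit : ∀ {j v} → Outside f v → count (insert v V[ f ∖ j ]) ≡ suc t′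
  count-V∖+exit {j} {v} out = trans (count-insert V[ f ∖ j ] v (Outside⇒∉V out ∘ V∖⊆V {j} v)) (cong suc (count-V∖ j))

  deg-closed : ∀ j → (∀ y → T (adj G (f j) y) → T (V[ f ] y)) → deg G (f j) ≡ t′
  deg-closed j N⊆V = trans (count-⊆-⊇ N⊆V∖ (V∖⊆N j)) (count-V∖ j)
    where
    N⊆V∖ : adj G (f j) ⊆ᵇ V[ f ∖ j ]
    N⊆V∖ y jy with V-elim (N⊆V y jy)
    ... | i , refl = ∈V∖ {i} {j} (λ { refl → adj⇒≢ {G = G} jy refl })

  deg-one-exit : ∀ j {v} → Outside f v → T (adj G (f j) v) →
    (∀ y → T (adj G (f j) y) → T (V[ f ] y) ⊎ y ≡ v) → deg G (f j) ≡ suc t′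
  deg-one-exit j {v} out jv N⊆V+v = trans (count-⊆-⊇ N⊆V∖+v (V∖+exit⊆N jv)) (count-V∖+exit {j} out)
    where
    N⊆V∖+v : adj G (f j) ⊆ᵇ insert v V[ f ∖ j ]
    N⊆V∖+v y jy with y ≟ v | N⊆V+v y jy
    ... | yes _ | _        = tt
    ... | no y≢v | inj₂ y≡v = ⊥-elim (y≢v y≡v)
    ... | no _  | inj₁ y∈ with V-elim y∈
    ...   | i , refl = ∈V∖ {i} {j} (λ { refl → adj⇒≢ {G = G} jy refl })

  deg-≥ : ∀ j {v} → Outside f v → T (adj G (f j) v) → suc t′ ≤ deg G (f j)
  deg-≥ j out jv = ≤-trans (≤-reflexive (sym (count-V∖+exit {j} out))) (count-mono (V∖+exit⊆N jv))

  nbrs-of-low : ∀ j → deg G (f j) ≡ t′ → ∀ y → T (adj G (f j) y) → ∃[ i ] (i ≢ j × y ≡ f i)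
  nbrs-of-low j d y jy = V∖-elim (count-≥⇒⊇ (V∖⊆N j) (≤-reflexive (trans d (sym (count-V∖ j)))) y jy)

  nbrs-of-high : ∀ j {v} → deg G (f j) ≡ suc t′ → Outside f v → T (adj G (f j) v) →
    ∀ y → T (adj G (f j) y) → (∃[ i ] (i ≢ j × y ≡ f i)) ⊎ y ≡ v
  nbrs-of-high j {v} d out jv y jy
    with T-∨ {does (y ≟ v)} .to (count-≥⇒⊇ (V∖+exit⊆N jv) (≤-reflexive (trans d (sym (count-V∖+exit {j} out)))) y jy)
  ... | inj₁ y≡v = inj₂ (does⇒ (y ≟ v) y≡v)
  ... | inj₂ y∈  = inj₁ (V∖-elim y∈)

replace-clique : ∀ {m n} {G : Graph n} {f : Fin m → Fin n} → IsKt m G f → ∀ a {w} → Outside f w →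
  (∀ c → c ≢ a → T (adj G (f c) w)) → IsKt m G (updateAt f a (const w))
replace-clique {G = G} {f} (f-inj , f-edge) a {w} w∉ sees-w = g-inj , g-edge
  where
  g = updateAt f a (const w)
  at : g a ≡ w
  at = updateAt-updates a f
  off : ∀ {c} → c ≢ a → g c ≡ f c
  off {c} c≢a = updateAt-minimal c a f c≢a
  g-inj : ∀ {c d} → g c ≡ g d → c ≡ d
  g-inj {c} {d} gc≡gd with c ≟ a | d ≟ a
  ... | yes refl | yes refl = refl
  ... | yes refl | no d≢a   = ⊥-elim (w∉ d (trans (sym (off d≢a)) (trans (sym gc≡gd) at)))
  ... | no c≢a   | yes refl = ⊥-elim (w∉ c (trans (sym (off c≢a)) (trans gc≡gd at)))
  ... | no c≢a   | no d≢a   = f-inj (trans (sym (off c≢a)) (trans gc≡gd (off d≢a)))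
  g-edge : ∀ c d → c ≢ d → T (adj G (g c) (g d))
  g-edge c d c≢d with c ≟ a | d ≟ a
  ... | yes refl | yes refl = ⊥-elim (c≢d refl)
  ... | yes refl | no d≢a   = subst₂ (λ u v → T (adj G u v)) (sym at) (sym (off d≢a)) (adj-sym {G = G} (sees-w d d≢a))
  ... | no c≢a   | yes refl = subst₂ (λ u v → T (adj G u v)) (sym (off c≢a)) (sym at) (sees-w c c≢a)
  ... | no c≢a   | no d≢a   = subst₂ (λ u v → T (adj G u v)) (sym (off c≢a)) (sym (off d≢a)) (f-edge c d c≢d)

module _ {m n} {f : Fin m → Fin n} (a : Fin m) {w : Fin n} where

  replace-outside : ∀ {x} → Outside f x → x ≢ w → Outside (updateAt f a (const w)) x
  replace-outside x∉ x≢w c gc≡x with c ≟ a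
  ... | yes refl = x≢w (trans (sym gc≡x) (updateAt-updates a f))
  ... | no c≢a   = x∉ c (trans (sym (updateAt-minimal c a f c≢a)) gc≡x)

  replace-removed : Injective _≡_ _≡_ f → Outside f w → Outside (updateAt f a (const w)) (f a)
  replace-removed f-inj w∉ c gc≡fa with c ≟ a
  ... | yes refl = w∉ a (trans (sym gc≡fa) (updateAt-updates a f))
  ... | no c≢a   = c≢a (f-inj (trans (sym (updateAt-minimal c a f c≢a)) gc≡fa))

open VertexSet

-- Every K_t is of type I or type II

module Classification {k n : ℕ} (G : Graph n) (connected : Connected G)
                      (saturated : Saturated (suc (suc (suc (suc k)))) G) where

  t : ℕ
  t = suc (suc (suc (suc k)))

  t∸1≢t : t ∸ 1 ≢ t
  t∸1≢t ()

  OnlyExit : (Fin t → Fin n) → Fin n → Set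
  OnlyExit f w = ∀ c y → Outside f y → T (adj G (f c) y) → y ≡ w

  ¬disjoint-pendants : ∀ {f} → IsKt t G f → ∀ {a b x y} → a ≢ b → Outside f x → Outside f y → x ≢ y →
    T (adj G (f a) x) → T (adj G (f b) y) → ⊥
  ¬disjoint-pendants {f} kt {a} {b} {x} {y} a≢b x∉ y∉ x≢y ax by =
    proj₁ (proj₂ saturated) (virus⇒contains (λ u v → adj-sym {G = G}) record
      { core = f ; core-clique = kt ; p = a ; q = b ; p≢q = a≢b ; x = x ; y = y
      ; x∉core = x∉ ; y∉core = y∉ ; x≢y = x≢y ; px = ax ; qy = by })

  outside-vertex : ∀ {f : Fin t → Fin n} → Injective _≡_ _≡_ f → ∀ w → ∃[ z ] (Outside f z × z ≢ w)
  outside-vertex {f} f-inj w with count<⇒∃∉ (insert w V[ f ]) count<n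
    where
    count<n : count (insert w V[ f ]) < n
    count<n = begin-strict
      count (insert w V[ f ]) ≤⟨ count-insert-≤ V[ f ] w ⟩
      suc (count V[ f ])      ≡⟨ cong suc (trans (count-image f f-inj (λ _ → true)) (count-true t)) ⟩
      suc t                   <⟨ ≤-refl ⟩
      suc (suc t)             ≡⟨ +-comm 2 t ⟩
      t + 2                   ≤⟨ proj₁ saturated ⟩
      n                       ∎
      where open ≤-Reasoning
  ... | z , z∉ = z , ∉V⇒Outside f (∉insert⇒∉ w V[ f ] z z∉) , ∉insert⇒≢ w V[ f ] z z∉

  fresh : (a b c : Fin t) → ∃[ d ] (d ≢ a × d ≢ b × d ≢ c)
  fresh a b c with count<⇒∃∉ abc (≤-trans (s≤s count≤3) (s≤s (s≤s (s≤s (s≤s z≤n)))))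
    where
    abc : Fin t → Bool
    abc = insert a (insert b (insert c (λ _ → false)))
    count≤3 : count abc ≤ 3
    count≤3 = ≤-trans (count-insert-≤ (insert b (insert c (λ _ → false))) a)
      (s≤s (≤-trans (count-insert-≤ (insert c (λ _ → false)) b)
      (s≤s (≤-trans (count-insert-≤ (λ _ → false) c) (s≤s (≤-reflexive (sumFin-zero t)))))))
  ... | d , d∉ = d , ∉insert⇒≢ a bc d d∉ , ∉insert⇒≢ b c′ d d∉bc , ∉insert⇒≢ c (λ _ → false) d (∉insert⇒∉ b c′ d d∉bc)
    where
    c′ bc : Fin t → Bool
    c′ = insert c (λ _ → false)
    bc = insert b c′
    d∉bc : ¬ T (bc d)
    d∉bc = ∉insert⇒∉ a bc d d∉

  pendants-coincide : ∀ {f} → IsKt t G f → ∀ {a b x y} → a ≢ b → Outside f x → Outside f y →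
    T (adj G (f a) x) → T (adj G (f b) y) → x ≡ y
  pendants-coincide kt {x = x} {y} a≢b x∉ y∉ ax by with x ≟ y
  ... | yes x≡y = x≡y
  ... | no x≢y  = ⊥-elim (¬disjoint-pendants kt a≢b x∉ y∉ x≢y ax by)

  data Exits (f : Fin t → Fin n) : Set where
    single : ∀ m {y} → Outside f y → (∀ b y → b ≢ m → Outside f y → ¬ T (adj G (f b) y)) → Exits f
    hub    : ∀ {w} → Outside f w → OnlyExit f w → ∀ m → T (adj G (f m) w) → Exits f

  exits : ∀ {f} → IsKt t G f → Exits f
  exits {f} kt with outside-vertex (proj₁ kt) (f zero)
  ... | z , z∉ , _ with walk-exit (connected (f zero) z) V[ f ] (∈V f) (Outside⇒∉V f z∉)
  ... | p , y , _ , p∈ , y∉V , py with V-elim f {p} p∈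
  ... | m , refl
      with any? (λ b → any? (λ y′ → ¬? (b ≟ m) ×-dec ¬? (T? (V[ f ] y′)) ×-dec T? (adj G (f b) y′)))
  ... | no none = single m y∉ λ b y′ b≢m y′∉ by′ → none (b , y′ , b≢m , Outside⇒∉V f y′∉ , by′)
    where y∉ = ∉V⇒Outside f {y} y∉V
  ... | yes (b , y′ , b≢m , y′∉V , by′) = hub y∉ only-y m py
    where
    y∉ = ∉V⇒Outside f {y} y∉V
    y′≡y : y′ ≡ y
    y′≡y = pendants-coincide kt b≢m (∉V⇒Outside f {y′} y′∉V) y∉ by′ py
    only-y : OnlyExit f y
    only-y c u u∉ cu with c ≟ m
    ... | no c≢m   = pendants-coincide kt c≢m u∉ y∉ cu py
    ... | yes refl = trans (pendants-coincide kt (b≢m ∘ sym) u∉ (∉V⇒Outside f {y′} y′∉V) cu by′) y′≡y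

  single⇒TypeI : ∀ {f} → IsKt t G f → ∀ m {y} → Outside f y →
    (∀ b y → b ≢ m → Outside f y → ¬ T (adj G (f b) y)) → TypeI t G f
  single⇒TypeI {f} kt m {y} y∉ no-other = m , cut , low
    where
    low : ∀ j → j ≢ m → deg G (f j) ≡ t ∸ 1
    low j j≢m = Clique.deg-closed {G = G} kt j closed
      where
      closed : ∀ u → T (adj G (f j) u) → T (V[ f ] u)
      closed u ju with T? (V[ f ] u)
      ... | yes u∈ = u∈
      ... | no u∉  = ⊥-elim (no-other j u j≢m (∉V⇒Outside f {u} u∉) ju)
    cut : CutVertex G (f m)
    cut with fresh m m m
    ... | b , b≢m , _ = f b , y , b≢m ∘ proj₁ kt , (λ y≡fm → y∉ m (sym y≡fm)) , trapped
      where
      trapped : ¬ Walk G (λ x → x ≢ f m) (f b) y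
      trapped w with walk-exit w V[ f ] (∈V f) (Outside⇒∉V f y∉)
      ... | p , q , p≢fm , p∈ , q∉ , pq with V-elim f {p} p∈
      ... | c , refl = no-other c q (p≢fm ∘ cong f) (∉V⇒Outside f {q} q∉) pq

  -- A walk from w to a vertex outside f ∪ {w} leaves that set along an edge w–q; replacing f a by w
  -- then gives a K_t with the disjoint pendant edges w–q and f b–f a.
  hub-misses-two : ∀ {f} → IsKt t G f → ∀ {w} → Outside f w → OnlyExit f w →
    ∀ a → ¬ (∀ c → c ≢ a → T (adj G (f c) w))
  hub-misses-two {f} kt {w} w∉ only-w a sees-w with outside-vertex (proj₁ kt) w
  ... | z , z∉ , z≢w with walk-exit (connected w z) (insert w V[ f ]) w∈ z∉W
    where
    w∈ : T (insert w V[ f ] w)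
    w∈ = T-∨ .from (inj₁ (does⇐ (w ≟ w) refl))
    z∉W : ¬ T (insert w V[ f ] z)
    z∉W h with T-∨ {does (z ≟ w)} .to h
    ... | inj₁ z≡w = z≢w (does⇒ (z ≟ w) z≡w)
    ... | inj₂ z∈  = Outside⇒∉V f z∉ z∈
  ... | p , q , _ , p∈ , q∉W , pq =
    ¬disjoint-pendants g-clique (b≢a ∘ sym) (replace-outside a q∉ q≢w) (replace-removed a (proj₁ kt) w∉)
      (q∉ a ∘ sym) (subst (λ u → T (adj G u q)) (sym (updateAt-updates a f)) wq)
      (subst (λ u → T (adj G u (f a))) (sym (updateAt-minimal b a f b≢a)) (proj₂ kt b a b≢a))
    where
    q∉ : Outside f q
    q∉ = ∉V⇒Outside f {q} (∉insert⇒∉ w V[ f ] q q∉W)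
    q≢w : q ≢ w
    q≢w = ∉insert⇒≢ w V[ f ] q q∉W
    wq : T (adj G w q)
    wq with T-∨ {does (p ≟ w)} .to p∈
    ... | inj₁ p≡w = subst (λ u → T (adj G u q)) (does⇒ (p ≟ w) p≡w) pq
    ... | inj₂ p∈V with V-elim f {p} p∈V
    ...   | c , refl = ⊥-elim (q≢w (only-w c q q∉ pq))
    g-clique : IsKt t G (updateAt f a (const w))
    g-clique = replace-clique {G = G} kt a w∉ sees-w
    b = proj₁ (fresh a a a)
    b≢a = proj₁ (proj₂ (fresh a a a))

  -- Adding the edge w–f j₁ creates a virus, and we locate w and f j₁ in it: w together with f j₁ or
  -- with another vertex of f in its core makes more than t − 3 clique vertices adjacent to w; f j₁ in
  -- the core without w forces the core to be f, so that both pendants are w; in the remaining cases the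
  -- virus, with f m as a pendant in place of f j₁ if needed, lies in G.
  module ThreeMisses {f} (kt : IsKt t G f) {w} (w∉ : Outside f w) (only-w : OnlyExit f w)
    {m} (mw : T (adj G (f m) w)) {j₁ j₂ j₃ : Fin t} (j₂≢j₁ : j₂ ≢ j₁) (j₃≢j₁ : j₃ ≢ j₁) (j₃≢j₂ : j₃ ≢ j₂)
    (¬j₁w : ¬ T (adj G (f j₁) w)) (¬j₂w : ¬ T (adj G (f j₂) w)) (¬j₃w : ¬ T (adj G (f j₃) w)) where

    v : Fin n
    v = f j₁

    w≢v : w ≢ v
    w≢v = w∉ j₁ ∘ sym

    E : Adjacency n
    E = addEdge (adj G) w v

    new-edge : ∀ {x y} → T (E x y) → ¬ T (adj G x y) → (x ≡ w × y ≡ v) ⊎ (x ≡ v × y ≡ w)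
    new-edge {x} {y} e ¬xy with T-∨ {adj G x y} .to e
    ... | inj₁ xy = ⊥-elim (¬xy xy)
    ... | inj₂ e′ with T-∨ {⌊ x ≟ w ⌋ ∧ ⌊ y ≟ v ⌋} .to e′
    ...   | inj₁ c = let (x≡w , y≡v) = T-∧ {⌊ x ≟ w ⌋} .to c in inj₁ (toWitness x≡w , toWitness y≡v)
    ...   | inj₂ c = let (x≡v , y≡w) = T-∧ {⌊ x ≟ v ⌋} .to c in inj₂ (toWitness x≡v , toWitness y≡w)

    old-edge-w : ∀ {x y} → T (E x y) → x ≢ w → y ≢ w → T (adj G x y)
    old-edge-w {x} {y} e x≢w y≢w with T? (adj G x y)
    ... | yes xy = xy
    ... | no ¬xy with new-edge e ¬xy
    ...   | inj₁ (x≡w , _) = ⊥-elim (x≢w x≡w)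
    ...   | inj₂ (_ , y≡w) = ⊥-elim (y≢w y≡w)

    old-edge-v : ∀ {x y} → T (E x y) → x ≢ v → y ≢ v → T (adj G x y)
    old-edge-v {x} {y} e x≢v y≢v with T? (adj G x y)
    ... | yes xy = xy
    ... | no ¬xy with new-edge e ¬xy
    ...   | inj₁ (_ , y≡v) = ⊥-elim (y≢v y≡v)
    ...   | inj₂ (x≡v , _) = ⊥-elim (x≢v x≡v)

    v-closed : ∀ y → T (adj G v y) → T (V[ f ] y)
    v-closed y vy with T? (V[ f ] y)
    ... | yes y∈ = y∈
    ... | no y∉  = ⊥-elim (¬j₁w (subst (λ u → T (adj G v u)) (only-w j₁ y (∉V⇒Outside f {y} y∉) vy) vy))

    Hubbed : Fin n → Bool
    Hubbed = image f (λ c → adj G (f c) w)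

    hubbed : ∀ {u} → T (V[ f ] u) → T (adj G u w) → T (Hubbed u)
    hubbed {u} u∈ uw with V-elim f {u} u∈
    ... | c , refl = image-intro {h = f} {p = λ c → adj G (f c) w} uw

    count-Hubbed : count Hubbed ≤ suc k
    count-Hubbed = begin
      count Hubbed                                                  ≡⟨ count-image f (proj₁ kt) (λ c → adj G (f c) w) ⟩
      count (λ c → adj G (f c) w)                                   ≤⟨ count-mono sees⊆others ⟩
      count (remove (remove (remove (λ _ → true) j₁) j₂) j₃)        ≡⟨ suc-injective (suc-injective (suc-injective
                                                                         (count-all-but-three j₂≢j₁ j₃≢j₁ j₃≢j₂))) ⟩
      suc k                                                         ∎
      where
      open ≤-Reasoning
      sees⊆others : (λ c → adj G (f c) w) ⊆ᵇ remove (remove (remove (λ _ → true) j₁) j₂) j₃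
      sees⊆others c cw = T-∧ {not (does (c ≟ j₁)) ∧ not (does (c ≟ j₂))} .from
        (T-∧ {not (does (c ≟ j₁))} .from (not-does⇐ (c ≟ j₁) (λ { refl → ¬j₁w cw }) , not-does⇐ (c ≟ j₂) (λ { refl → ¬j₂w cw }))
        , not-does⇐ (c ≟ j₃) (λ { refl → ¬j₃w cw }))

    module _ (V : Virus t E) where
      open Virus V renaming (core to g)

      g-inj : Injective _≡_ _≡_ g
      g-inj = proj₁ core-clique

      g-clique-avoiding-v : Outside g v → IsKt t G g
      g-clique-avoiding-v v∉g = g-inj , λ r s r≢s → old-edge-v (proj₂ core-clique r s r≢s) (v∉g r) (v∉g s)

      g-clique-avoiding-w : Outside g w → IsKt t G g
      g-clique-avoiding-w w∉g = g-inj , λ r s r≢s → old-edge-w (proj₂ core-clique r s r≢s) (w∉g r) (w∉g s)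

      too-many-hubbed : ∀ {P : Fin t → Bool} → (∀ r → T (P r) → T (Hubbed (g r))) → suc (suc k) ≤ count P → ⊥
      too-many-hubbed P⇒hubbed many = <⇒≱ (s≤s count-Hubbed) (≤-trans many (count-injective g g-inj P⇒hubbed))

      hub-and-v-in : ∀ {a c} → g a ≡ w → g c ≡ v → ⊥
      hub-and-v-in {a} {c} ga≡w gc≡v =
        too-many-hubbed {remove (remove (λ _ → true) a) c} hubbed-others
          (≤-reflexive (sym (suc-injective (suc-injective (count-all-but-two {a = a} {c} (a≢c ∘ sym))))))
        where
        a≢c : a ≢ c
        a≢c a≡c = w≢v (trans (sym ga≡w) (trans (cong g a≡c) gc≡v))
        hubbed-others : ∀ r → T (remove (remove (λ _ → true) a) c r) → T (Hubbed (g r))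
        hubbed-others r r∉ac = hubbed (v-closed (g r) (adj-sym {G = G} (subst (λ u → T (adj G (g r) u)) gc≡v rv)))
                                      (subst (λ u → T (adj G (g r) u)) ga≡w rw)
          where
          r≢a : r ≢ a
          r≢a = not-does⇒ (r ≟ a) (proj₁ (T-∧ {not (does (r ≟ a))} .to r∉ac))
          r≢c : r ≢ c
          r≢c = not-does⇒ (r ≟ c) (proj₂ (T-∧ {not (does (r ≟ a))} .to r∉ac))
          rv : T (adj G (g r) (g c))
          rv = old-edge-w (proj₂ core-clique r c r≢c) (λ e → r≢a (g-inj (trans e (sym ga≡w)))) (λ e → a≢c (g-inj (trans ga≡w (sym e))))
          rw : T (adj G (g r) (g a))
          rw = old-edge-v (proj₂ core-clique r a r≢a) (λ e → r≢c (g-inj (trans e (sym gc≡v)))) (λ e → a≢c (g-inj (trans e (sym gc≡v))))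

      only-hub-in : ∀ {a} → g a ≡ w → Outside g v → ⊥
      only-hub-in {a} ga≡w v∉g
        with any? (λ r → ¬? (r ≟ a) ×-dec T? (V[ f ] (g r)))
      ... | yes (r₀ , r₀≢a , r₀∈) =
        too-many-hubbed {remove (λ _ → true) a} hubbed-others
          (≤-trans (n≤1+n _) (≤-reflexive (sym (suc-injective (count-all-but-one a)))))
        where
        in-f : ∀ r → r ≢ a → T (V[ f ] (g r))
        in-f r r≢a with r ≟ r₀ | T? (V[ f ] (g r))
        ... | yes refl | _      = r₀∈
        ... | no _     | yes r∈ = r∈
        ... | no r≢r₀  | no r∉ with V-elim f {g r₀} r₀∈
        ...   | c₀ , gr₀≡fc₀ = ⊥-elim (r≢a (g-inj (trans (only-w c₀ (g r) (∉V⇒Outside f {g r} r∉)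
                   (subst (λ u → T (adj G u (g r))) gr₀≡fc₀ (proj₂ (g-clique-avoiding-v v∉g) r₀ r (r≢r₀ ∘ sym)))) (sym ga≡w))))
        hubbed-others : ∀ r → T (remove (λ _ → true) a r) → T (Hubbed (g r))
        hubbed-others r r∉a = hubbed (in-f r r≢a)
          (subst (λ u → T (adj G (g r) u)) ga≡w (proj₂ (g-clique-avoiding-v v∉g) r a r≢a))
          where r≢a = not-does⇒ (r ≟ a) r∉a
      ... | no none = pendants
        where
        g-clique = g-clique-avoiding-v v∉g
        others-outside : ∀ r → r ≢ a → Outside f (g r)
        others-outside r r≢a = ∉V⇒Outside f {g r} (λ r∈ → none (r , r≢a , r∈))
        fm∉g : Outside g (f m)
        fm∉g r gr≡fm with r ≟ a
        ... | yes refl = w∉ m (trans (sym gr≡fm) ga≡w)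
        ... | no r≢a   = others-outside r r≢a m (sym gr≡fm)
        new-pendant : ∀ {r z} → T (E (g r) z) → ¬ T (adj G (g r) z) → r ≡ a
        new-pendant {r} e ¬gz with new-edge e ¬gz
        ... | inj₁ (gr≡w , _) = g-inj (trans gr≡w (sym ga≡w))
        ... | inj₂ (gr≡v , _) = ⊥-elim (v∉g r gr≡v)
        fm-pendant : ∀ {r s z} → r ≡ a → s ≢ r → T (adj G (g s) z) → Outside g z → f m ≢ z
        fm-pendant {r} {s} refl s≢a sz z∉g refl =
          s≢a (g-inj (trans (only-w m (g s) (others-outside s s≢a) (adj-sym {G = G} sz)) (sym ga≡w)))
        wm : ∀ {r} → r ≡ a → T (adj G (g r) (f m))
        wm refl = subst (λ u → T (adj G u (f m))) (sym ga≡w) (adj-sym {G = G} mw)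
        pendants : ⊥
        pendants with T? (adj G (g p) x) | T? (adj G (g q) y)
        ... | yes gx | yes gy = ¬disjoint-pendants g-clique p≢q x∉core y∉core x≢y gx gy
        ... | no ¬gx | yes gy = ¬disjoint-pendants g-clique p≢q fm∉g y∉core
                                  (fm-pendant (new-pendant px ¬gx) (p≢q ∘ sym) gy y∉core) (wm (new-pendant px ¬gx)) gy
        ... | yes gx | no ¬gy = ¬disjoint-pendants g-clique p≢q x∉core fm∉g
                                  (fm-pendant (new-pendant qy ¬gy) p≢q gx x∉core ∘ sym) gx (wm (new-pendant qy ¬gy))
        ... | no ¬gx | no ¬gy = p≢q (trans (new-pendant px ¬gx) (sym (new-pendant qy ¬gy)))

      only-v-in : ∀ {c} → g c ≡ v → Outside g w → ⊥
      only-v-in {c} gc≡v w∉g = x≢y (trans (pendant-is-w x∉core px) (sym (pendant-is-w y∉core qy)))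
        where
        g-clique = g-clique-avoiding-w w∉g
        g⊆f : V[ g ] ⊆ᵇ V[ f ]
        g⊆f u u∈ with V-elim g {u} u∈
        ... | r , refl with r ≟ c
        ...   | yes refl = subst (λ u → T (V[ f ] u)) (sym gc≡v) (∈V f)
        ...   | no r≢c   = v-closed (g r) (adj-sym {G = G} (subst (λ u → T (adj G (g r) u)) gc≡v (proj₂ g-clique r c r≢c)))
        outside-g⇒outside-f : ∀ {z} → Outside g z → Outside f z
        outside-g⇒outside-f {z} z∉g = ∉V⇒Outside f {z} λ z∈ → Outside⇒∉V g z∉g
          (count-≥⇒⊇ g⊆f (≤-reflexive (trans (count-image f (proj₁ kt) (λ _ → true)) (sym (count-image g g-inj (λ _ → true))))) z z∈)
        pendant-is-w : ∀ {r z} → Outside g z → T (E (g r) z) → z ≡ w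
        pendant-is-w {r} {z} z∉g e with T? (adj G (g r) z)
        ... | yes gz with V-elim f {g r} (g⊆f (g r) (∈V g))
        ...   | c′ , gr≡fc′ = only-w c′ z (outside-g⇒outside-f z∉g) (subst (λ u → T (adj G u z)) gr≡fc′ gz)
        pendant-is-w {r} z∉g e | no ¬gz with new-edge e ¬gz
        ...   | inj₁ (gr≡w , _) = ⊥-elim (w∉g r gr≡w)
        ...   | inj₂ (_ , z≡w)  = z≡w

      neither-in : Outside g w → Outside g v → ⊥
      neither-in w∉g v∉g = ¬disjoint-pendants (g-clique-avoiding-v v∉g) p≢q x∉core y∉core x≢y (old px) (old qy)
        where
        old : ∀ {r z} → T (E (g r) z) → T (adj G (g r) z)
        old {r} {z} e with T? (adj G (g r) z)
        ... | yes gz = gz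
        ... | no ¬gz with new-edge e ¬gz
        ...   | inj₁ (gr≡w , _) = ⊥-elim (w∉g r gr≡w)
        ...   | inj₂ (gr≡v , _) = ⊥-elim (v∉g r gr≡v)

      impossible : ⊥
      impossible with T? (V[ g ] w) | T? (V[ g ] v)
      ... | yes w∈ | yes v∈ = hub-and-v-in (sym (proj₂ (V-elim g {w} w∈))) (sym (proj₂ (V-elim g {v} v∈)))
      ... | yes w∈ | no v∉  = only-hub-in (sym (proj₂ (V-elim g {w} w∈))) (∉V⇒Outside g {v} v∉)
      ... | no w∉  | yes v∈ = only-v-in (sym (proj₂ (V-elim g {v} v∈))) (∉V⇒Outside g {w} w∉)
      ... | no w∉  | no v∉  = neither-in (∉V⇒Outside g {w} w∉) (∉V⇒Outside g {v} v∉)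

    three-misses : ⊥
    three-misses = impossible (contains⇒virus (proj₂ (proj₂ saturated) w v w≢v (¬T-≡-false (¬j₁w ∘ adj-sym {G = G}))))

  module Hub {f} (kt : IsKt t G f) {w} (w∉ : Outside f w) (only-w : OnlyExit f w) where

    deg-missing-hub : ∀ j → ¬ T (adj G (f j) w) → deg G (f j) ≡ t ∸ 1
    deg-missing-hub j ¬jw = Clique.deg-closed {G = G} kt j closed
      where
      closed : ∀ y → T (adj G (f j) y) → T (V[ f ] y)
      closed y jy with T? (V[ f ] y)
      ... | yes y∈ = y∈
      ... | no y∉  = ⊥-elim (¬jw (subst (λ u → T (adj G (f j) u)) (only-w j y (∉V⇒Outside f {y} y∉) jy) jy))

    deg-seeing-hub : ∀ c → T (adj G (f c) w) → deg G (f c) ≡ t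
    deg-seeing-hub c cw = Clique.deg-one-exit {G = G} kt c w∉ cw exits-to-w
      where
      exits-to-w : ∀ y → T (adj G (f c) y) → T (V[ f ] y) ⊎ y ≡ w
      exits-to-w y cy with T? (V[ f ] y)
      ... | yes y∈ = inj₁ y∈
      ... | no y∉  = inj₂ (only-w c y (∉V⇒Outside f {y} y∉) cy)

  MissesThree : (Fin t → Fin n) → Fin n → Set
  MissesThree f w = ∃[ j₁ ] ∃[ j₂ ] ∃[ j₃ ] (j₂ ≢ j₁ × j₃ ≢ j₁ × j₃ ≢ j₂
    × ¬ T (adj G (f j₁) w) × ¬ T (adj G (f j₂) w) × ¬ T (adj G (f j₃) w))

  misses-three? : ∀ f w → Dec (MissesThree f w)
  misses-three? f w = any? λ j₁ → any? λ j₂ → any? λ j₃ → ¬? (j₂ ≟ j₁) ×-dec ¬? (j₃ ≟ j₁) ×-dec ¬? (j₃ ≟ j₂)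
    ×-dec ¬? (T? (adj G (f j₁) w)) ×-dec ¬? (T? (adj G (f j₂) w)) ×-dec ¬? (T? (adj G (f j₃) w))

  module _ {f} (kt : IsKt t G f) {w} (w∉ : Outside f w) (only-w : OnlyExit f w) (¬three : ¬ MissesThree f w) where
    open Hub kt w∉ only-w

    two-missers⇒TypeII : ∀ {j₁ j₂} → j₂ ≢ j₁ → ¬ T (adj G (f j₁) w) → ¬ T (adj G (f j₂) w) → TypeII t G f
    two-missers⇒TypeII {j₁} {j₂} j₂≢j₁ ¬j₁w ¬j₂w =
      j₁ , j₂ , j₂≢j₁ ∘ sym , deg-missing-hub j₁ ¬j₁w , deg-missing-hub j₂ ¬j₂w ,
      (λ c c≢j₁ c≢j₂ → deg-seeing-hub c (sees c c≢j₁ c≢j₂)) ,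
      w , w∉ , λ c c≢j₁ c≢j₂ → adj-sym {G = G} (sees c c≢j₁ c≢j₂)
      where
      sees : ∀ c → c ≢ j₁ → c ≢ j₂ → T (adj G (f c) w)
      sees c c≢j₁ c≢j₂ = decidable-stable (T? (adj G (f c) w))
        (λ ¬cw → ¬three (j₁ , j₂ , c , j₂≢j₁ , c≢j₁ , c≢j₂ , ¬j₁w , ¬j₂w , ¬cw))

    second-misser : ∀ {j₁} → ¬ T (adj G (f j₁) w) →
      Dec (∃[ j₂ ] (j₂ ≢ j₁ × ¬ T (adj G (f j₂) w))) → TypeII t G f
    second-misser ¬j₁w (yes (j₂ , j₂≢j₁ , ¬j₂w)) = two-missers⇒TypeII j₂≢j₁ ¬j₁w ¬j₂w
    second-misser {j₁} ¬j₁w (no ¬two) = ⊥-elim (hub-misses-two kt w∉ only-w j₁ λ c c≢j₁ →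
      decidable-stable (T? (adj G (f c) w)) (λ ¬cw → ¬two (c , c≢j₁ , ¬cw)))

    first-misser : Dec (∃[ j₁ ] ¬ T (adj G (f j₁) w)) → TypeII t G f
    first-misser (yes (j₁ , ¬j₁w)) = second-misser ¬j₁w (any? λ j → ¬? (j ≟ j₁) ×-dec ¬? (T? (adj G (f j) w)))
    first-misser (no ¬one) = ⊥-elim (hub-misses-two kt w∉ only-w zero λ c _ →
      decidable-stable (T? (adj G (f c) w)) (λ ¬cw → ¬one (c , ¬cw)))

  classify-by-exits : ∀ {f} → IsKt t G f → Exits f → TypeI t G f ⊎ TypeII t G f
  classify-by-exits kt (single m y∉ no-other) = inj₁ (single⇒TypeI kt m y∉ no-other)
  classify-by-exits {f} kt (hub {w} w∉ only-w m mw) with misses-three? f w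
  ... | yes (j₁ , j₂ , j₃ , j₂≢j₁ , j₃≢j₁ , j₃≢j₂ , ¬j₁w , ¬j₂w , ¬j₃w) =
    ⊥-elim (ThreeMisses.three-misses kt w∉ only-w mw j₂≢j₁ j₃≢j₁ j₃≢j₂ ¬j₁w ¬j₂w ¬j₃w)
  ... | no ¬three = inj₂ (first-misser kt w∉ only-w ¬three (any? λ j → ¬? (T? (adj G (f j) w))))

  classify : ∀ {f} → IsKt t G f → TypeI t G f ⊎ TypeII t G f
  classify kt = classify-by-exits kt (exits kt)

  ¬TypeI×TypeII : ∀ {f} → TypeI t G f → TypeII t G f → ⊥
  ¬TypeI×TypeII (ℓ , _ , low) (i , j , _ , _ , _ , high , _) with fresh i j ℓ
  ... | c , c≢i , c≢j , c≢ℓ = t∸1≢t (trans (sym (low c c≢ℓ)) (high c c≢i c≢j))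

-- The graph G′ of surviving vertices

module Survivors {k n : ℕ} (G : Graph n) (connected : Connected G)
                 (saturated : Saturated (suc (suc (suc (suc k)))) G) where

  open Classification G connected saturated
  module C {f} (kt : IsKt t G f) = Clique {G = G} kt

  low≢high : ∀ {x y} → deg G x ≡ t ∸ 1 → deg G y ≡ t → x ≢ y
  low≢high dx dy refl = t∸1≢t (trans (sym dx) dy)

  lucky-exit : ∀ {f} → IsKt t G f → ∀ {i} → LuckyAt t G f i → ∃[ y ] (Outside f y × T (adj G (f i) y))
  lucky-exit {f} kt {i} (_ , low) with outside-vertex (proj₁ kt) (f i)
  ... | z , z∉ , _ with walk-exit (connected (f i) z) V[ f ] (∈V f) (Outside⇒∉V f z∉)
  ... | p , y , _ , p∈ , y∉ , py with V-elim f {p} p∈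
  ... | c , refl with c ≟ i
  ... | yes refl = y , ∉V⇒Outside f {y} y∉ , py
  ... | no c≢i with C.nbrs-of-low kt c (low c c≢i) y py
  ... | m , _ , refl = ⊥-elim (y∉ (∈V f))

  two-others : (a b : Fin t) → ∃₂ λ s₁ s₂ → s₁ ≢ a × s₁ ≢ b × s₂ ≢ a × s₂ ≢ b × s₂ ≢ s₁
  two-others a b with fresh a b a
  ... | s₁ , s₁≢a , s₁≢b , _ with fresh a b s₁
  ... | s₂ , s₂≢a , s₂≢b , s₂≢s₁ = s₁ , s₂ , s₁≢a , s₁≢b , s₂≢a , s₂≢b , s₂≢s₁

  lucky-not-surplus : ∀ {f} → IsKt t G f → ∀ {i} → LuckyAt t G f i →
    ∀ {g} → IsKt t G g → ∀ {i′ j′} → (∀ c → c ≢ i′ → c ≢ j′ → deg G (g c) ≡ t) →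
    ∀ {v′} → Outside g v′ → (∀ c → c ≢ i′ → c ≢ j′ → T (adj G v′ (g c))) →
    ∀ {c} → c ≢ i′ → c ≢ j′ → g c ≡ f i → ⊥
  lucky-not-surplus {f} kt {i} (_ , low) {g} g-kt {i′} {j′} high′ {v′} v′∉ v′g {c} c≢i′ c≢j′ gc≡fi =
    two-surplus (two-others i′ j′)
    where
    into-g : ∀ u → u ≢ i → f u ≢ v′ → ∃[ r ] f u ≡ g r
    into-g u u≢i fu≢v′ with C.nbrs-of-high g-kt c (high′ c c≢i′ c≢j′) v′∉ (adj-sym {G = G} (v′g c c≢i′ c≢j′))
                              (f u) (subst (λ x → T (adj G x (f u))) (sym gc≡fi) (proj₂ kt i u (u≢i ∘ sym)))
    ... | inj₁ (r , _ , fu≡gr) = r , fu≡gr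
    ... | inj₂ fu≡v′ = ⊥-elim (fu≢v′ fu≡v′)
    shared : ∃[ u ] (u ≢ i × ∃[ r ] f u ≡ g r)
    shared = pick (two-others i i)
      where
      pick : (∃₂ λ u₁ u₂ → u₁ ≢ i × u₁ ≢ i × u₂ ≢ i × u₂ ≢ i × u₂ ≢ u₁) → ∃[ u ] (u ≢ i × ∃[ r ] f u ≡ g r)
      pick (u₁ , u₂ , u₁≢i , _ , u₂≢i , _ , u₂≢u₁) = choose (f u₁ ≟ v′)
        where
        choose : Dec (f u₁ ≡ v′) → ∃[ u ] (u ≢ i × ∃[ r ] f u ≡ g r)
        choose (no fu₁≢v′)  = u₁ , u₁≢i , into-g u₁ u₁≢i fu₁≢v′
        choose (yes fu₁≡v′) = u₂ , u₂≢i , into-g u₂ u₂≢i (λ fu₂≡v′ → u₂≢u₁ (proj₁ kt (trans fu₂≡v′ (sym fu₁≡v′))))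
    g⊆f : ∀ s → ∃[ m ] g s ≡ f m
    g⊆f s = via shared
      where
      via : ∃[ u ] (u ≢ i × ∃[ r ] f u ≡ g r) → ∃[ m ] g s ≡ f m
      via (u , u≢i , r , fu≡gr) = case (s ≟ r)
        where
        case : Dec (s ≡ r) → ∃[ m ] g s ≡ f m
        case (yes refl) = u , sym fu≡gr
        case (no s≢r) = Data.Product.map₂ proj₂ (C.nbrs-of-low kt u (low u u≢i) (g s)
          (subst (λ x → T (adj G x (g s))) (sym fu≡gr) (proj₂ g-kt r s (s≢r ∘ sym))))
    surplus-is-fi : ∀ s → s ≢ i′ → s ≢ j′ → g s ≡ f i
    surplus-is-fi s s≢i′ s≢j′ = via (g⊆f s)
      where
      via : ∃[ m ] g s ≡ f m → g s ≡ f i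
      via (m , gs≡fm) = case (m ≟ i)
        where
        case : Dec (m ≡ i) → g s ≡ f i
        case (yes refl) = gs≡fm
        case (no m≢i) = ⊥-elim (low≢high (low m m≢i) (high′ s s≢i′ s≢j′) (sym gs≡fm))
    two-surplus : (∃₂ λ s₁ s₂ → s₁ ≢ i′ × s₁ ≢ j′ × s₂ ≢ i′ × s₂ ≢ j′ × s₂ ≢ s₁) → ⊥
    two-surplus (s₁ , s₂ , s₁≢i′ , s₁≢j′ , s₂≢i′ , s₂≢j′ , s₂≢s₁) =
      s₂≢s₁ (proj₁ g-kt (trans (surplus-is-fi s₂ s₂≢i′ s₂≢j′) (sym (surplus-is-fi s₁ s₁≢i′ s₁≢j′))))

  lucky-not-deleted : ∀ {f} → IsKt t G f → ∀ {i} → LuckyAt t G f i → ¬ Deleted t G (f i)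
  lucky-not-deleted {f} kt {i} lk = not-deleted
    where
    high : t ≤ deg G (f i)
    high = let (y , y∉ , iy) = lucky-exit kt lk in C.deg-≥ kt i y∉ iy
    not-low : ∀ {x} → x ≡ f i → deg G x ≡ t ∸ 1 → ⊥
    not-low refl low = <-irrefl refl (≤-trans high (≤-reflexive low))
    in-typeII : ∀ {g} → IsKt t G g → TypeII t G g → ∀ {c} → g c ≡ f i → ⊥
    in-typeII g-kt (i′ , j′ , _ , low-i′ , low-j′ , high′ , v′ , v′∉ , v′g) {c} gc≡fi = by-index (c ≟ i′) (c ≟ j′)
      where
      by-index : Dec (c ≡ i′) → Dec (c ≡ j′) → ⊥
      by-index (yes refl) _          = not-low gc≡fi low-i′
      by-index (no _)     (yes refl) = not-low gc≡fi low-j′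
      by-index (no c≢i′)  (no c≢j′)  = lucky-not-surplus kt lk g-kt high′ v′∉ v′g c≢i′ c≢j′ gc≡fi
    not-deleted : ¬ Deleted t G (f i)
    not-deleted (inj₁ (g , g-kt , typeII , c , gc≡fi))            = in-typeII g-kt typeII gc≡fi
    not-deleted (inj₂ (g , g-kt , ℓ , (_ , low′) , c , c≢ℓ , gc≡fi)) = not-low gc≡fi (low′ c c≢ℓ)

  module Anchor {f} (kt : IsKt t G f) {i j} (low-i : deg G (f i) ≡ t ∸ 1) (low-j : deg G (f j) ≡ t ∸ 1)
    (high : ∀ c → c ≢ i → c ≢ j → deg G (f c) ≡ t)
    {v} (v∉ : Outside f v) (vf : ∀ c → c ≢ i → c ≢ j → T (adj G v (f c))) where

    low-misses-anchor : ∀ {d} → deg G (f d) ≡ t ∸ 1 → ¬ T (adj G (f d) v)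
    low-misses-anchor {d} low dv = let (m , _ , v≡fm) = C.nbrs-of-low kt d low v dv in v∉ m (sym v≡fm)

    anchor-nbr-high : ∀ {m} → T (adj G (f m) v) → deg G (f m) ≡ t
    anchor-nbr-high {m} mv = by-index (m ≟ i) (m ≟ j)
      where
      by-index : Dec (m ≡ i) → Dec (m ≡ j) → deg G (f m) ≡ t
      by-index (yes refl) _          = ⊥-elim (low-misses-anchor low-i mv)
      by-index (no _)     (yes refl) = ⊥-elim (low-misses-anchor low-j mv)
      by-index (no m≢i)   (no m≢j)   = high m m≢i m≢j

    surplus-nbrs : ∀ s → s ≢ i → s ≢ j → ∀ y → T (adj G (f s) y) → (∃[ m ] (m ≢ s × y ≡ f m)) ⊎ y ≡ v
    surplus-nbrs s s≢i s≢j = C.nbrs-of-high kt s (high s s≢i s≢j) v∉ (adj-sym {G = G} (vf s s≢i s≢j))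

    low-nbr-of-surplus-misses-anchor : ∀ {s x} → s ≢ i → s ≢ j → T (adj G (f s) x) → deg G x ≡ t ∸ 1 →
      x ≢ v → ¬ T (adj G x v)
    low-nbr-of-surplus-misses-anchor {s} {x} s≢i s≢j sx low-x x≢v xv with surplus-nbrs s s≢i s≢j x sx
    ... | inj₂ x≡v = x≢v x≡v
    ... | inj₁ (m , _ , x≡fm) = low≢high low-x (anchor-nbr-high (subst (λ u → T (adj G u v)) x≡fm xv)) x≡fm

    not-unlucky : ∀ {g} → IsKt t G g → ∀ {ℓ} → LuckyAt t G g ℓ → ∀ {c} → c ≢ ℓ → g c ≡ v → ⊥
    not-unlucky {g} g-kt {ℓ} (_ , low′) {c} c≢ℓ gc≡v = two-surplus (two-others i j)
      where
      surplus-is-lucky : ∀ s → s ≢ i → s ≢ j → f s ≡ g ℓ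
      surplus-is-lucky s s≢i s≢j = via (C.nbrs-of-low g-kt c (low′ c c≢ℓ) (f s)
                                        (subst (λ u → T (adj G u (f s))) (sym gc≡v) (vf s s≢i s≢j)))
        where
        via : ∃[ r ] (r ≢ c × f s ≡ g r) → f s ≡ g ℓ
        via (r , _ , fs≡gr) = by-index (r ≟ ℓ)
          where
          by-index : Dec (r ≡ ℓ) → f s ≡ g ℓ
          by-index (yes refl) = fs≡gr
          by-index (no r≢ℓ)   = ⊥-elim (low≢high (low′ r r≢ℓ) (high s s≢i s≢j) (sym fs≡gr))
      two-surplus : (∃₂ λ s₁ s₂ → s₁ ≢ i × s₁ ≢ j × s₂ ≢ i × s₂ ≢ j × s₂ ≢ s₁) → ⊥
      two-surplus (s₁ , s₂ , s₁≢i , s₁≢j , s₂≢i , s₂≢j , s₂≢s₁) =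
        s₂≢s₁ (proj₁ kt (trans (surplus-is-lucky s₂ s₂≢i s₂≢j) (sym (surplus-is-lucky s₁ s₁≢i s₁≢j))))

    not-low-in-typeII : ∀ {g} → IsKt t G g → ∀ {d d′} → d′ ≢ d → deg G (g d) ≡ t ∸ 1 → deg G (g d′) ≡ t ∸ 1 →
      g d ≡ v → ⊥
    not-low-in-typeII {g} g-kt {d} {d′} d′≢d low-d low-d′ gd≡v = pick (fresh i j i)
      where
      pick : ∃[ s ] (s ≢ i × s ≢ j × s ≢ i) → ⊥
      pick (s , s≢i , s≢j , _) = via (C.nbrs-of-low g-kt d low-d (f s)
                                      (subst (λ u → T (adj G u (f s))) (sym gd≡v) (vf s s≢i s≢j)))
        where
        via : ∃[ r ] (r ≢ d × f s ≡ g r) → ⊥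
        via (r , _ , fs≡gr) = by-index (r ≟ d′)
          where
          by-index : Dec (r ≡ d′) → ⊥
          by-index (yes refl) = low≢high low-d′ (high s s≢i s≢j) (sym fs≡gr)
          by-index (no r≢d′)  = low-nbr-of-surplus-misses-anchor s≢i s≢j
            (subst (λ u → T (adj G u (g d′))) (sym fs≡gr) (proj₂ g-kt r d′ r≢d′)) low-d′
            (λ gd′≡v → d′≢d (proj₁ g-kt (trans gd′≡v (sym gd≡v))))
            (subst (λ u → T (adj G (g d′) u)) gd≡v (proj₂ g-kt d′ d d′≢d))

    not-high-in-typeII : ∀ {g} → IsKt t G g → ∀ {i′ j′} → deg G (g i′) ≡ t ∸ 1 → deg G (g j′) ≡ t ∸ 1 →
      (∀ c → c ≢ i′ → c ≢ j′ → deg G (g c) ≡ t) → ∀ {v′} → Outside g v′ →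
      (∀ c → c ≢ i′ → c ≢ j′ → T (adj G v′ (g c))) → ∀ {c} → c ≢ i′ → c ≢ j′ → g c ≡ v → ⊥
    not-high-in-typeII {g} g-kt {i′} {j′} low-i′ low-j′ high′ {v′} v′∉ v′g {c} c≢i′ c≢j′ gc≡v = pick (two-others i j)
      where
      from-surplus : ∀ {s} → s ≢ i → s ≢ j → f s ≢ v′ → ⊥
      from-surplus {s} s≢i s≢j fs≢v′ = via (C.nbrs-of-high g-kt c (high′ c c≢i′ c≢j′) v′∉ (adj-sym {G = G} (v′g c c≢i′ c≢j′))
                                            (f s) (subst (λ u → T (adj G u (f s))) (sym gc≡v) (vf s s≢i s≢j)))
        where
        via : (∃[ r ] (r ≢ c × f s ≡ g r)) ⊎ f s ≡ v′ → ⊥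
        via (inj₂ fs≡v′) = fs≢v′ fs≡v′
        via (inj₁ (r , _ , fs≡gr)) = by-index (r ≟ i′) (r ≟ j′)
          where
          by-index : Dec (r ≡ i′) → Dec (r ≡ j′) → ⊥
          by-index (yes refl) _          = low≢high low-i′ (high s s≢i s≢j) (sym fs≡gr)
          by-index (no _)     (yes refl) = low≢high low-j′ (high s s≢i s≢j) (sym fs≡gr)
          by-index (no r≢i′)  (no _)     = low-nbr-of-surplus-misses-anchor s≢i s≢j
            (subst (λ u → T (adj G u (g i′))) (sym fs≡gr) (proj₂ g-kt r i′ r≢i′)) low-i′
            (λ gi′≡v → c≢i′ (proj₁ g-kt (trans gc≡v (sym gi′≡v))))
            (subst (λ u → T (adj G (g i′) u)) gc≡v (proj₂ g-kt i′ c (c≢i′ ∘ sym)))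
      pick : (∃₂ λ s₁ s₂ → s₁ ≢ i × s₁ ≢ j × s₂ ≢ i × s₂ ≢ j × s₂ ≢ s₁) → ⊥
      pick (s₁ , s₂ , s₁≢i , s₁≢j , s₂≢i , s₂≢j , s₂≢s₁) = by-anchor (f s₁ ≟ v′)
        where
        by-anchor : Dec (f s₁ ≡ v′) → ⊥
        by-anchor (no fs₁≢v′)  = from-surplus s₁≢i s₁≢j fs₁≢v′
        by-anchor (yes fs₁≡v′) = from-surplus s₂≢i s₂≢j (λ fs₂≡v′ → s₂≢s₁ (proj₁ kt (trans fs₂≡v′ (sym fs₁≡v′))))

    anchor-not-deleted : ¬ Deleted t G v
    anchor-not-deleted (inj₂ (g , g-kt , ℓ , lk , c , c≢ℓ , gc≡v)) = not-unlucky g-kt lk c≢ℓ gc≡v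
    anchor-not-deleted (inj₁ (g , g-kt , (i′ , j′ , i′≢j′ , low-i′ , low-j′ , high′ , v′ , v′∉ , v′g) , c , gc≡v)) =
      by-index (c ≟ i′) (c ≟ j′)
      where
      by-index : Dec (c ≡ i′) → Dec (c ≡ j′) → ⊥
      by-index (yes refl) _          = not-low-in-typeII g-kt (i′≢j′ ∘ sym) low-i′ low-j′ gc≡v
      by-index (no _)     (yes refl) = not-low-in-typeII g-kt i′≢j′ low-j′ low-i′ gc≡v
      by-index (no c≢i′)  (no c≢j′)  = not-high-in-typeII g-kt low-i′ low-j′ high′ v′∉ v′g c≢i′ c≢j′ gc≡v

  module _ (del : Fin n → Bool) (del-sound : ∀ x → T (del x) → Deleted t G x)
           (del-complete : ∀ x → Deleted t G x → T (del x)) where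

    unlucky-pocket : ∀ {f} → IsKt t G f → ∀ {i} → LuckyAt t G f i → ∀ {c} → c ≢ i → Pocket {G = G} del (f c)
    unlucky-pocket {f} kt {i} lk {c} c≢i = record
      { inside     = V[ f ∖ i ]
      ; gate       = f i
      ; x-inside   = ∈V∖ f c≢i
      ; inside⊆del = λ y y∈ → let (m , m≢i , y≡fm) = V∖-elim f {i} {y} y∈ in
                                del-complete y (inj₂ (f , kt , i , lk , m , m≢i , sym y≡fm))
      ; gate-kept  = lucky-not-deleted kt lk ∘ del-sound (f i)
      ; closed     = closed
      }
      where
      by-index : ∀ {m} → Dec (m ≡ i) → T (V[ f ∖ i ] (f m)) ⊎ f m ≡ f i
      by-index (yes refl) = inj₂ refl
      by-index (no m≢i)   = inj₁ (∈V∖ f m≢i)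
      closed : ∀ z y → T (V[ f ∖ i ] z) → T (adj G z y) → T (V[ f ∖ i ] y) ⊎ y ≡ f i
      closed z y z∈ zy = from-z (V∖-elim f {i} {z} z∈)
        where
        from-z : ∃[ m ] (m ≢ i × z ≡ f m) → T (V[ f ∖ i ] y) ⊎ y ≡ f i
        from-z (m , m≢i , refl) = from-nbr (C.nbrs-of-low kt m (proj₂ lk m m≢i) y zy)
          where
          from-nbr : ∃[ m′ ] (m′ ≢ m × y ≡ f m′) → T (V[ f ∖ i ] y) ⊎ y ≡ f i
          from-nbr (m′ , _ , refl) = by-index (m′ ≟ i)

    typeII-pocket : ∀ {f} → IsKt t G f → (typeII : TypeII t G f) → ∀ c → Pocket {G = G} del (f c)
    typeII-pocket {f} kt typeII@(i , j , _ , low-i , low-j , high , v , v∉ , vf) c = record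
      { inside     = V[ f ]
      ; gate       = v
      ; x-inside   = ∈V f
      ; inside⊆del = λ y y∈ → let (m , y≡fm) = V-elim f {y} y∈ in
                                del-complete y (inj₁ (f , kt , typeII , m , sym y≡fm))
      ; gate-kept  = Anchor.anchor-not-deleted kt low-i low-j high v∉ vf ∘ del-sound v
      ; closed     = closed
      }
      where
      in-f : ∀ {m y} → ∃[ m′ ] (m′ ≢ m × y ≡ f m′) → T (V[ f ] y)
      in-f (m′ , _ , refl) = ∈V f
      closed : ∀ z y → T (V[ f ] z) → T (adj G z y) → T (V[ f ] y) ⊎ y ≡ v
      closed z y z∈ zy = from-z (V-elim f {z} z∈)
        where
        from-z : ∃[ m ] z ≡ f m → T (V[ f ] y) ⊎ y ≡ v
        from-z (m , refl) = by-index (m ≟ i) (m ≟ j)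
          where
          by-index : Dec (m ≡ i) → Dec (m ≡ j) → T (V[ f ] y) ⊎ y ≡ v
          by-index (yes refl) _          = inj₁ (in-f (C.nbrs-of-low kt m low-i y zy))
          by-index (no _)     (yes refl) = inj₁ (in-f (C.nbrs-of-low kt m low-j y zy))
          by-index (no m≢i)   (no m≢j)   = Data.Sum.map₁ in-f (Anchor.surplus-nbrs kt low-i low-j high v∉ vf m m≢i m≢j y zy)

    deleted-pocket : ∀ {x} → Deleted t G x → Pocket {G = G} del x
    deleted-pocket (inj₁ (f , kt , typeII , c , refl))       = typeII-pocket kt typeII c
    deleted-pocket (inj₂ (f , kt , i , lk , c , c≢i , refl)) = unlucky-pocket kt lk c≢i

    kept-connected : ConnectedOn G (λ x → del x ≡ false)
    kept-connected = connectedOn-kept (λ x → deleted-pocket ∘ del-sound x) connected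

    kept-Kt-free : KtFreeOn t G (λ x → del x ≡ false)
    kept-Kt-free f kt all-kept = has-deleted (classify kt)
      where
      kept-deleted : ∀ {x} → del x ≡ false → ¬ Deleted t G x
      kept-deleted {x} kept d = subst T kept (del-complete x d)
      has-deleted : TypeI t G f ⊎ TypeII t G f → ⊥
      has-deleted (inj₁ (i , lk)) = let (c , c≢i , _) = fresh i i i in
        kept-deleted (all-kept c) (inj₂ (f , kt , i , lk , c , c≢i , refl))
      has-deleted (inj₂ typeII) = kept-deleted (all-kept zero) (inj₁ (f , kt , typeII , zero , refl))

    keptDeg : Fin n → ℕ
    keptDeg x = count (λ y → not (del y) ∧ adj G x y)

    high? : Fin n → Bool
    high? y = deg G y ≡ᵇ t

    -- Discharging: every deleted vertex of degree t sends one unit to each deleted neighbour.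
    DeletedEdge : Fin n → Fin n → Bool
    DeletedEdge x y = del x ∧ del y ∧ adj G x y

    received sent : Fin n → ℕ
    received x = count (λ y → DeletedEdge x y ∧ high? y)
    sent     x = count (λ y → DeletedEdge x y ∧ high? x)

    Balanced : ℕ → Fin n → Set
    Balanced excess x = 2 * t + sent x + excess ≡ 2 * (deg G x + keptDeg x) + received x

    private
      deleted-edge : ∀ {x y} → T (del x) → T (del y) → T (adj G x y) → T (DeletedEdge x y)
      deleted-edge dx dy xy = T-∧ .from (dx , T-∧ .from (dy , xy))

      deleted-edge-elim : ∀ {x y} → T (DeletedEdge x y) → T (del y) × T (adj G x y)
      deleted-edge-elim {x} h = T-∧ .to (proj₂ (T-∧ {del x} .to h))

      kept-adj : ∀ {x y} → ¬ T (del y) → T (adj G x y) → T (not (del y) ∧ adj G x y)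
      kept-adj ¬dy xy = T-∧ .from (T-not-≡ .from (¬T-≡-false ¬dy) , xy)

      kept-adj-elim : ∀ {x y} → T (not (del y) ∧ adj G x y) → ¬ T (del y) × T (adj G x y)
      kept-adj-elim h = let (ndy , xy) = T-∧ .to h in (λ dy → subst T (T-not-≡ .to ndy) dy) , xy

      high?-intro : ∀ {y} → deg G y ≡ t → T (high? y)
      high?-intro {y} d = ≡⇒≡ᵇ (deg G y) t d

      low⇒¬high? : ∀ {y} → deg G y ≡ t ∸ 1 → ¬ T (high? y)
      low⇒¬high? {y} d h = t∸1≢t (trans (sym d) (≡ᵇ⇒≡ (deg G y) t h))

    balanced-from : ∀ {x d κ a b e} → deg G x ≡ d → keptDeg x ≡ κ → received x ≡ a → sent x ≡ b →
      2 * t + b + e ≡ 2 * (d + κ) + a → Balanced e x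
    balanced-from refl refl refl refl arithmetic = arithmetic

    module _ {f} (kt : IsKt t G f) where
      edge : ∀ a b → a ≢ b → T (adj G (f a) (f b))
      edge = proj₂ kt

      unlucky-balanced : ∀ {i} → LuckyAt t G f i → ∀ {c} → c ≢ i → Balanced 0 (f c)
      unlucky-balanced {i} lk@(_ , low) {c} c≢i =
        balanced-from (low c c≢i) keptDeg≡1 received≡0 sent≡0 (solve 1 (λ k → con 2 :* (con 4 :+ k) :+ con 0 :+ con 0
          := con 2 :* ((con 3 :+ k) :+ con 1) :+ con 0) refl k)
        where
        lucky-kept : ¬ T (del (f i))
        lucky-kept = lucky-not-deleted kt lk ∘ del-sound (f i)
        member-deleted : ∀ {m} → m ≢ i → T (del (f m))
        member-deleted {m} m≢i = del-complete (f m) (inj₂ (f , kt , i , lk , m , m≢i , refl))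
        nbrs : ∀ y → T (adj G (f c) y) → ∃[ m ] (m ≢ c × y ≡ f m)
        nbrs = C.nbrs-of-low kt c (low c c≢i)
        keptDeg≡1 : keptDeg (f c) ≡ 1
        keptDeg≡1 = trans (count-⊆-⊇ only-lucky lucky) (count-single (f i))
          where
          only-lucky : (λ y → not (del y) ∧ adj G (f c) y) ⊆ᵇ (λ y → does (y ≟ f i))
          only-lucky y h = let (¬dy , cy) = kept-adj-elim h ; (m , _ , y≡fm) = nbrs y cy in by-index (m ≟ i) ¬dy y≡fm
            where
            by-index : ∀ {m} → Dec (m ≡ i) → ¬ T (del y) → y ≡ f m → T (does (y ≟ f i))
            by-index (yes refl) _ y≡fi = does⇐ (y ≟ f i) y≡fi
            by-index (no m≢i) ¬dy refl = ⊥-elim (¬dy (member-deleted m≢i))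
          lucky : (λ y → does (y ≟ f i)) ⊆ᵇ (λ y → not (del y) ∧ adj G (f c) y)
          lucky y h with does⇒ (y ≟ f i) h
          ... | refl = kept-adj lucky-kept (edge c i c≢i)
        received≡0 : received (f c) ≡ 0
        received≡0 = count-none {p = λ y → DeletedEdge (f c) y ∧ high? y} λ y h → let (e , hy) = T-∧ {DeletedEdge (f c) y} .to h ; (dy , cy) = deleted-edge-elim e ; (m , _ , y≡fm) = nbrs y cy in
          by-index (m ≟ i) (subst (T ∘ del) y≡fm dy) (subst (T ∘ high?) y≡fm hy)
          where
          by-index : ∀ {m} → Dec (m ≡ i) → T (del (f m)) → T (high? (f m)) → ⊥
          by-index (yes refl) dm _  = lucky-kept dm
          by-index {m} (no m≢i) _ hm = low⇒¬high? (low m m≢i) hm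
        sent≡0 : sent (f c) ≡ 0
        sent≡0 = count-none {p = λ y → DeletedEdge (f c) y ∧ high? (f c)} λ y h → low⇒¬high? (low c c≢i) (proj₂ (T-∧ {DeletedEdge (f c) y} .to h))

      module _ (typeII : TypeII t G f) where
        member-deleted : ∀ m → T (del (f m))
        member-deleted m = del-complete (f m) (inj₁ (f , kt , typeII , m , refl))

        low-balanced : ∀ {d d′} → d′ ≢ d → deg G (f d) ≡ t ∸ 1 → deg G (f d′) ≡ t ∸ 1 →
          (∀ c → c ≢ d → c ≢ d′ → deg G (f c) ≡ t) → Balanced k (f d)
        low-balanced {d} {d′} d′≢d low-d low-d′ high =
          balanced-from low-d keptDeg≡0 received≡t-2 sent≡0 (solve 1 (λ k → con 2 :* (con 4 :+ k) :+ con 0 :+ k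
            := con 2 :* ((con 3 :+ k) :+ con 0) :+ (con 2 :+ k)) refl k)
          where
          nbrs : ∀ y → T (adj G (f d) y) → ∃[ m ] (m ≢ d × y ≡ f m)
          nbrs = C.nbrs-of-low kt d low-d
          keptDeg≡0 : keptDeg (f d) ≡ 0
          keptDeg≡0 = count-none {p = λ y → not (del y) ∧ adj G (f d) y} λ y h →
            let (¬dy , dy) = kept-adj-elim h ; (m , _ , y≡fm) = nbrs y dy in ¬dy (subst (T ∘ del) (sym y≡fm) (member-deleted m))
          others : Fin t → Bool
          others = remove (remove (λ _ → true) d) d′
          received≡t-2 : received (f d) ≡ suc (suc k)
          received≡t-2 = trans (count-⊆-⊇ ⊆others others⊆) (trans (count-image f (proj₁ kt) others)
            (suc-injective (suc-injective (count-all-but-two d′≢d))))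
            where
            ⊆others : (λ y → DeletedEdge (f d) y ∧ high? y) ⊆ᵇ image f others
            ⊆others y h = let (e , hy) = T-∧ {DeletedEdge (f d) y} .to h ; (_ , dy) = deleted-edge-elim e
                              (m , m≢d , y≡fm) = nbrs y dy in
              subst (T ∘ image f others) (sym y≡fm) (image-intro {h = f} {p = others}
                (T-∧ .from (not-does⇐ (m ≟ d) m≢d , not-does⇐ (m ≟ d′) λ m≡d′ → low⇒¬high? low-d′ (subst (T ∘ high? ∘ f) m≡d′ (subst (T ∘ high?) y≡fm hy)))))
            others⊆ : image f others ⊆ᵇ (λ y → DeletedEdge (f d) y ∧ high? y)
            others⊆ y h with image-elim {h = f} {p = others} h
            ... | m , m∈ , refl = let (m≢d , m≢d′) = T-∧ {not (does (m ≟ d))} .to m∈ in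
              T-∧ .from (deleted-edge (member-deleted d) (member-deleted m) (edge d m (not-does⇒ (m ≟ d) m≢d ∘ sym)) ,
                         high?-intro (high m (not-does⇒ (m ≟ d) m≢d) (not-does⇒ (m ≟ d′) m≢d′)))
          sent≡0 : sent (f d) ≡ 0
          sent≡0 = count-none {p = λ y → DeletedEdge (f d) y ∧ high? (f d)} λ y h →
            low⇒¬high? low-d (proj₂ (T-∧ {DeletedEdge (f d) y} .to h))

        high-balanced : ∀ {i j} → j ≢ i → deg G (f i) ≡ t ∸ 1 → deg G (f j) ≡ t ∸ 1 →
          (high : ∀ c → c ≢ i → c ≢ j → deg G (f c) ≡ t) → ∀ {v} → (v∉ : Outside f v) →
          (vf : ∀ c → c ≢ i → c ≢ j → T (adj G v (f c))) → ∀ {c} → c ≢ i → c ≢ j → Balanced 0 (f c)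
        high-balanced {i} {j} j≢i low-i low-j high {v} v∉ vf {c} c≢i c≢j =
          balanced-from (high c c≢i c≢j) keptDeg≡1 received≡t-3 sent≡t-1
            (solve 1 (λ k → con 2 :* (con 4 :+ k) :+ (con 3 :+ k) :+ con 0
              := con 2 :* ((con 4 :+ k) :+ con 1) :+ (con 1 :+ k)) refl k)
          where
          anchor-kept : ¬ T (del v)
          anchor-kept = Anchor.anchor-not-deleted kt low-i low-j high v∉ vf ∘ del-sound v
          nbrs : ∀ y → T (adj G (f c) y) → (∃[ m ] (m ≢ c × y ≡ f m)) ⊎ y ≡ v
          nbrs = Anchor.surplus-nbrs kt low-i low-j high v∉ vf c c≢i c≢j
          deleted-nbr : ∀ {y} → T (del y) → T (adj G (f c) y) → ∃[ m ] (m ≢ c × y ≡ f m)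
          deleted-nbr {y} dy cy = Data.Sum.[ (λ m → m) , (λ y≡v → ⊥-elim (anchor-kept (subst (T ∘ del) y≡v dy))) ]′ (nbrs y cy)
          keptDeg≡1 : keptDeg (f c) ≡ 1
          keptDeg≡1 = trans (count-⊆-⊇ only-anchor anchor) (count-single v)
            where
            only-anchor : (λ y → not (del y) ∧ adj G (f c) y) ⊆ᵇ (λ y → does (y ≟ v))
            only-anchor y h = let (¬dy , cy) = kept-adj-elim h in Data.Sum.[
              (λ { (m , _ , y≡fm) → ⊥-elim (¬dy (subst (T ∘ del) (sym y≡fm) (member-deleted m))) }) ,
              does⇐ (y ≟ v) ]′ (nbrs y cy)
            anchor : (λ y → does (y ≟ v)) ⊆ᵇ (λ y → not (del y) ∧ adj G (f c) y)
            anchor y h with does⇒ (y ≟ v) h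
            ... | refl = kept-adj anchor-kept (adj-sym {G = G} (vf c c≢i c≢j))
          others : Fin t → Bool
          others = remove (remove (remove (λ _ → true) i) j) c
          received≡t-3 : received (f c) ≡ suc k
          received≡t-3 = trans (count-⊆-⊇ ⊆others others⊆) (trans (count-image f (proj₁ kt) others)
            (suc-injective (suc-injective (suc-injective (count-all-but-three j≢i c≢i c≢j)))))
            where
            ⊆others : (λ y → DeletedEdge (f c) y ∧ high? y) ⊆ᵇ image f others
            ⊆others y h = let (e , hy) = T-∧ {DeletedEdge (f c) y} .to h ; (dy , cy) = deleted-edge-elim e
                              (m , m≢c , y≡fm) = deleted-nbr dy cy ; hm = subst (T ∘ high?) y≡fm hy in
              subst (T ∘ image f others) (sym y≡fm) (image-intro {h = f} {p = others}
                (T-∧ .from (T-∧ .from (not-does⇐ (m ≟ i) (λ m≡i → low⇒¬high? low-i (subst (T ∘ high? ∘ f) m≡i hm)) ,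
                                        not-does⇐ (m ≟ j) (λ m≡j → low⇒¬high? low-j (subst (T ∘ high? ∘ f) m≡j hm))) ,
                            not-does⇐ (m ≟ c) m≢c)))
            others⊆ : image f others ⊆ᵇ (λ y → DeletedEdge (f c) y ∧ high? y)
            others⊆ y h with image-elim {h = f} {p = others} h
            ... | m , m∈ , refl =
              let (m∉ij , m≢c) = T-∧ {not (does (m ≟ i)) ∧ not (does (m ≟ j))} .to m∈
                  (m≢i , m≢j) = T-∧ {not (does (m ≟ i))} .to m∉ij in
              T-∧ .from (deleted-edge (member-deleted c) (member-deleted m) (edge c m (not-does⇒ (m ≟ c) m≢c ∘ sym)) ,
                         high?-intro (high m (not-does⇒ (m ≟ i) m≢i) (not-does⇒ (m ≟ j) m≢j)))
          sent≡t-1 : sent (f c) ≡ suc (suc (suc k))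
          sent≡t-1 = trans (count-⊆-⊇ ⊆rest rest⊆) (C.count-V∖ kt c)
            where
            ⊆rest : (λ y → DeletedEdge (f c) y ∧ high? (f c)) ⊆ᵇ V[ f ∖ c ]
            ⊆rest y h = let (dy , cy) = deleted-edge-elim (proj₁ (T-∧ {DeletedEdge (f c) y} .to h))
                            (m , m≢c , y≡fm) = deleted-nbr dy cy in
              subst (T ∘ V[ f ∖ c ]) (sym y≡fm) (∈V∖ f m≢c)
            rest⊆ : V[ f ∖ c ] ⊆ᵇ (λ y → DeletedEdge (f c) y ∧ high? (f c))
            rest⊆ y h with V∖-elim f {c} {y} h
            ... | m , m≢c , refl = T-∧ .from (deleted-edge (member-deleted c) (member-deleted m) (edge c m (m≢c ∘ sym)) ,
                                              high?-intro (high c c≢i c≢j))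

    Charged : ℕ → Fin n → Set
    Charged excess x = 2 * t * indicator (del x) + sent x + excess ≡ 2 * lostDegree G del x + received x

    deleted-charged : ∀ {x e} → T (del x) → Balanced e x → Charged e x
    deleted-charged {x} {e} dx balanced = begin
      2 * t * indicator (del x) + sent x + e       ≡⟨ cong (λ b → 2 * t * indicator b + sent x + e) (T-≡ .to dx) ⟩
      2 * t * 1 + sent x + e                       ≡⟨ cong (λ z → z + sent x + e) (*-identityʳ (2 * t)) ⟩
      2 * t + sent x + e                           ≡⟨ balanced ⟩
      2 * (deg G x + keptDeg x) + received x       ≡⟨ cong (λ z → 2 * z + received x) lost≡ ⟨
      2 * lostDegree G del x + received x          ∎
      where
      open ≡-Reasoning
      lost≡ : lostDegree G del x ≡ deg G x + keptDeg x
      lost≡ = cong₂ _+_ (count-cong (λ y → cong (_∧ adj G x y) (T-≡ .to dx)))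
                        (count-cong (λ y → cong (_∧ (not (del y) ∧ adj G x y)) (T-≡ .to dx)))

    kept-charged : ∀ {x} → ¬ T (del x) → Charged 0 x
    kept-charged {x} ¬dx = begin
      2 * t * indicator (del x) + sent x + 0    ≡⟨ cong₂ (λ b s → 2 * t * indicator b + s + 0) (¬T-≡-false ¬dx) (edge-none (high? x)) ⟩
      2 * t * 0 + 0 + 0                         ≡⟨ cong (λ z → z + 0 + 0) (*-zeroʳ (2 * t)) ⟩
      0                                         ≡⟨ cong₂ (λ l r → 2 * (l + r) + 0) (none (adj G x)) (none (λ y → not (del y) ∧ adj G x y)) ⟨
      2 * lostDegree G del x + 0                ≡⟨ cong (2 * lostDegree G del x +_) (edge-none′ high?) ⟨
      2 * lostDegree G del x + received x       ∎
      where
      open ≡-Reasoning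
      none : (p : Fin n → Bool) → count (λ y → del x ∧ p y) ≡ 0
      none p = count-none {p = λ y → del x ∧ p y} λ y h → ¬dx (proj₁ (T-∧ {del x} {p y} .to h))
      edge-none : (b : Bool) → count (λ y → DeletedEdge x y ∧ b) ≡ 0
      edge-none b = count-none {p = λ y → DeletedEdge x y ∧ b} λ y h → ¬dx (proj₁ (T-∧ {del x} .to (proj₁ (T-∧ {DeletedEdge x y} .to h))))
      edge-none′ : (p : Fin n → Bool) → count (λ y → DeletedEdge x y ∧ p y) ≡ 0
      edge-none′ p = count-none {p = λ y → DeletedEdge x y ∧ p y} λ y h → ¬dx (proj₁ (T-∧ {del x} .to (proj₁ (T-∧ {DeletedEdge x y} .to h))))

    typeII-deficit-charged : ∀ {f} → IsKt t G f → (typeII : TypeII t G f) → Charged k (f (proj₁ typeII))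
    typeII-deficit-charged kt typeII@(i , j , i≢j , low-i , low-j , high , _) =
      deleted-charged (member-deleted kt typeII i) (low-balanced kt typeII (i≢j ∘ sym) low-i low-j high)

    vertex-charged : ∀ x → Charged 0 x ⊎ (Charged k x × ∃[ f ] (IsKt t G f × TypeII t G f))
    vertex-charged x = by-deletion (T? (del x))
      where
      of-deleted : T (del x) → Deleted t G x → Charged 0 x ⊎ (Charged k x × ∃[ f ] (IsKt t G f × TypeII t G f))
      of-deleted dx (inj₂ (f , kt , i , lk , c , c≢i , refl)) = inj₁ (deleted-charged dx (unlucky-balanced kt lk c≢i))
      of-deleted dx (inj₁ (f , kt , typeII@(i , j , i≢j , low-i , low-j , high , v , v∉ , vf) , c , refl)) =
        by-index (c ≟ i) (c ≟ j)
        where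
        by-index : Dec (c ≡ i) → Dec (c ≡ j) → Charged 0 (f c) ⊎ (Charged k (f c) × ∃[ f ] (IsKt t G f × TypeII t G f))
        by-index (yes refl) _ = inj₂ (deleted-charged dx (low-balanced kt typeII (i≢j ∘ sym) low-i low-j high) , f , kt , typeII)
        by-index (no _) (yes refl) =
          inj₂ (deleted-charged dx (low-balanced kt typeII i≢j low-j low-i (λ c′ c′≢j c′≢i → high c′ c′≢i c′≢j)) , f , kt , typeII)
        by-index (no c≢i) (no c≢j) = inj₁ (deleted-charged dx (high-balanced kt typeII (i≢j ∘ sym) low-i low-j high v∉ vf c≢i c≢j))
      by-deletion : Dec (T (del x)) → Charged 0 x ⊎ (Charged k x × ∃[ f ] (IsKt t G f × TypeII t G f))
      by-deletion (yes dx) = of-deleted dx (del-sound x dx)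
      by-deletion (no ¬dx) = inj₁ (kept-charged ¬dx)

    DeletedEdge-sym : ∀ x y → DeletedEdge x y ≡ DeletedEdge y x
    DeletedEdge-sym x y = swap (del x) (del y) (Graph.sym G x y)
      where
      swap : ∀ a b {e e′} → e ≡ e′ → a ∧ b ∧ e ≡ b ∧ a ∧ e′
      swap true  true  refl = refl
      swap true  false refl = refl
      swap false true  refl = refl
      swap false false refl = refl

    charge-≤ : ∀ x → 2 * t * indicator (del x) + sent x ≤ 2 * lostDegree G del x + received x
    charge-≤ x = Data.Sum.[ (λ ch → ≤-reflexive (trans (sym (+-identityʳ _)) ch))
                          , (λ ch,f → ≤-trans (m≤m+n _ k) (≤-reflexive (proj₁ ch,f))) ]′ (vertex-charged x)

    Tight : Set
    Tight = ∀ x → 2 * t * indicator (del x) + sent x ≡ 2 * lostDegree G del x + received x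

    tight⇔ : Tight ⇔ (k ≡ 0 ⊎ (∀ f → IsKt t G f → TypeI t G f))
    tight⇔ = mk⇔ tight⇒ ⇒tight
      where
      tight⇒ : Tight → k ≡ 0 ⊎ (∀ f → IsKt t G f → TypeI t G f)
      tight⇒ tight = by-k k refl
        where
        no-excess : ∀ {f} → IsKt t G f → TypeII t G f → k ≡ 0
        no-excess {f} kt typeII = +-cancelˡ-≡ _ k 0 (trans (typeII-deficit-charged kt typeII)
          (trans (sym (tight (f (proj₁ typeII)))) (sym (+-identityʳ _))))
        by-k : ∀ k′ → k ≡ k′ → k ≡ 0 ⊎ (∀ f → IsKt t G f → TypeI t G f)
        by-k zero    k≡0 = inj₁ k≡0
        by-k (suc _) k≡s = inj₂ λ f kt → Data.Sum.[ (λ typeI → typeI)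
          , (λ typeII → ⊥-elim (0≢1+n (trans (sym (no-excess kt typeII)) k≡s))) ]′ (classify kt)
      ⇒tight : k ≡ 0 ⊎ (∀ f → IsKt t G f → TypeI t G f) → Tight
      ⇒tight condition x = Data.Sum.[ (λ ch → trans (sym (+-identityʳ _)) ch) , excess-vanishes ]′ (vertex-charged x)
        where
        excess-vanishes : Charged k x × ∃[ f ] (IsKt t G f × TypeII t G f) → _
        excess-vanishes (ch , f , kt , typeII) = Data.Sum.[ (λ { refl → trans (sym (+-identityʳ _)) ch })
                                                          , (λ all-I → ⊥-elim (¬TypeI×TypeII (all-I f kt) typeII)) ]′ condition

    private
      discharged = discharging (λ x → 2 * t * indicator (del x)) (λ x → 2 * lostDegree G del x) received sent
                     (count-transfer DeletedEdge DeletedEdge-sym high?) charge-≤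
      Σcharge : sumFin (λ x → 2 * t * indicator (del x)) ≡ 2 * (t * count del)
      Σcharge = trans (sumFin-*ˡ (2 * t) (indicator ∘ del)) (*-assoc 2 t (count del))
      Σlost : sumFin (λ x → 2 * lostDegree G del x) ≡ 2 * sumFin (lostDegree G del)
      Σlost = sumFin-*ˡ 2 (lostDegree G del)

    lost-≥ : t * count del ≤ sumFin (lostDegree G del)
    lost-≥ = *-cancelˡ-≤ 2 (subst₂ _≤_ Σcharge Σlost (proj₁ discharged))

    edge-bound : 2 * edgesIn G (not ∘ del) + t * count del ≤ 2 * edges G
    edge-bound = subst (2 * edgesIn G (not ∘ del) + t * count del ≤_) (sym (edges-after-deletion G del)) (+-monoʳ-≤ (2 * edgesIn G (not ∘ del)) lost-≥)

    edge-bound-tight⇔ : (2 * edges G ≡ 2 * edgesIn G (not ∘ del) + t * count del) ⇔ Tight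
    edge-bound-tight⇔ = mk⇔
      (λ tight-edges → proj₂ discharged .to (trans Σcharge (trans (cong (2 *_) (sym (lost≡ tight-edges))) (sym Σlost))))
      (λ tight → trans (edges-after-deletion G del) (cong (2 * edgesIn G (not ∘ del) +_)
        (sym (*-cancelˡ-≡ (t * count del) _ 2 (trans (sym Σcharge) (trans (proj₂ discharged .from tight) Σlost))))))
      where
      lost≡ : 2 * edges G ≡ 2 * edgesIn G (not ∘ del) + t * count del → sumFin (lostDegree G del) ≡ t * count del
      lost≡ tight-edges = +-cancelˡ-≡ (2 * edgesIn G (not ∘ del)) _ _ (trans (sym (edges-after-deletion G del)) tight-edges)

lemma2p1 : (t n : ℕ) → 4 ≤ t → (G : Graph n) → Connected G → Saturated t G →
    (del : Fin n → Bool) →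
    (∀ x → T (del x) → Deleted t G x) → (∀ x → Deleted t G x → T (del x)) →
    ConnectedOn G (λ x → del x ≡ false)
    × KtFreeOn t G (λ x → del x ≡ false)
    × (2 * edgesIn G (λ x → not (del x)) + t * count del ≤ 2 * edges G)
    × ((2 * edges G ≡ 2 * edgesIn G (λ x → not (del x)) + t * count del)
        ⇔ (t ≡ 4 ⊎ (∀ f → IsKt t G f → TypeI t G f)))
lemma2p1 _ n (s≤s (s≤s (s≤s (s≤s (z≤n {k}))))) G connected saturated del sound complete =
  kept-connected del sound complete ,
  kept-Kt-free del sound complete ,
  edge-bound del sound complete ,
  ⇔-trans (edge-bound-tight⇔ del sound complete) (⇔-trans (tight⇔ del sound complete) k≡0⇔t≡4)
  where
  open Survivors G connected saturated
  k≡0⇔t≡4 : ∀ {P : Set} → (k ≡ 0 ⊎ P) ⇔ (suc (suc (suc (suc k))) ≡ 4 ⊎ P)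
  k≡0⇔t≡4 = mk⇔ (Data.Sum.map₁ (cong (λ m → suc (suc (suc (suc m))))))
                (Data.Sum.map₁ (cong (λ m → m ∸ 4)))
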